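{- Let $d\ge0$ and $\mathbb{F}$ a field. Let $\mathcal{T}_d(\mathbb{F})$ be the set of very good upper triangular matrices in ${\rm Mat}_{d+1}(\mathbb{F})$ and $VF_d(\mathbb{F})$ the set of functions $\Delta_d\to\mathbb{F}\setminus\{0\}$. Then the map $D:\mathcal{T}_d(\mathbb{F})\to VF_d(\mathbb{F})$, $D(T)((r,s,t))=\det(T[t,d-r])$, is a bijection.
   Context: $\Delta_d=\{(r,s,t)\in\mathbb{N}^3:r+s+t=d\}$. Matrices are indexed by $0,\dots,d$; for $0\le i\le j\le d$, $T[i,j]$ is the submatrix with rows $0,\dots,j-i$ and columns $i,\dots,j$; $T$ is very good if every $T[i,j]$ is invertible (so $D(T)$ indeed takes nonzero values). -}

module Defs where

open import Level using (Level; _⊔_) renaming (suc to lsuc)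
open import Algebra.Bundles using (CommutativeRing)
open import Data.Nat using (ℕ; zero; suc; _∸_; _≤_; _<_; _<?_) renaming (_+_ to _+ℕ_)
open import Data.Fin using (Fin; toℕ; fromℕ<; punchIn; _≟_) renaming (zero to fzero; suc to fsuc)
open import Data.Product using (Σ; ∃; _×_; _,_)
open import Relation.Nullary using (¬_; yes; no)
open import Relation.Binary.PropositionalEquality using (_≡_)

record Field (c ℓ : Level) : Set (lsuc (c ⊔ ℓ)) where
  field
    commutativeRing : CommutativeRing c ℓ
  open CommutativeRing commutativeRing public
  field
    0≉1 : ¬ (0# ≈ 1#)
    inverse : ∀ x → ¬ (x ≈ 0#) → ∃ λ y → x * y ≈ 1#

module _ {c ℓ : Level} (F : Field c ℓ) where
  open Field F

  Matrix : ℕ → Set c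
  Matrix n = Fin n → Fin n → Carrier

  Σᶠ : (n : ℕ) → (Fin n → Carrier) → Carrier
  Σᶠ zero    f = 0#
  Σᶠ (suc n) f = f fzero + Σᶠ n (λ i → f (fsuc i))

  alt : ℕ → Carrier → Carrier
  alt zero    x = x
  alt (suc k) x = - alt k x

  det : (n : ℕ) → Matrix n → Carrier
  det zero    M = 1#
  det (suc n) M =
    Σᶠ (suc n) (λ j → alt (toℕ j) (M fzero j * det n (λ a b → M (fsuc a) (punchIn j b))))

  _·_ : {n : ℕ} → Matrix n → Matrix n → Matrix n
  _·_ {n} A B i k = Σᶠ n (λ j → A i j * B j k)

  I : {n : ℕ} → Matrix n
  I i j with i ≟ j
  ... | yes _ = 1#
  ... | no  _ = 0#

  _≈ₘ_ : {n : ℕ} → Matrix n → Matrix n → Set ℓ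
  A ≈ₘ B = ∀ i j → A i j ≈ B i j

  Invertible : {n : ℕ} → Matrix n → Set (c ⊔ ℓ)
  Invertible {n} A = Σ (Matrix n) λ B → ((A · B) ≈ₘ I) × ((B · A) ≈ₘ I)

  -- entry (a , b) of an n × n matrix, read with natural-number indices
  -- (0# outside the range; only used in range below)
  at : {n : ℕ} → Matrix n → ℕ → ℕ → Carrier
  at {n} M a b with a <? n | b <? n
  ... | yes a<n | yes b<n = M (fromℕ< a<n) (fromℕ< b<n)
  ... | _       | _       = 0#

  -- T[i,j] : rows 0,…,j-i and columns i,…,j  (size j-i+1), for i ≤ j ≤ d
  sub : {n : ℕ} → Matrix n → (i j : ℕ) → Matrix (suc (j ∸ i))
  sub M i j a b = at M (toℕ a) (i +ℕ toℕ b)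

  UpperTriangular : {n : ℕ} → Matrix n → Set ℓ
  UpperTriangular M = ∀ i j → toℕ j < toℕ i → M i j ≈ 0#

  VeryGood : (d : ℕ) → Matrix (suc d) → Set (c ⊔ ℓ)
  VeryGood d T = ∀ i j → i ≤ j → j ≤ d → Invertible (sub T i j)

  𝒯 : ℕ → Set (c ⊔ ℓ)
  𝒯 d = Σ (Matrix (suc d)) λ T → UpperTriangular T × VeryGood d T

  FunΔ : ℕ → Set c
  FunΔ d = (r s t : ℕ) → r +ℕ s +ℕ t ≡ d → Carrier

  NonVanishing : {d : ℕ} → FunΔ d → Set ℓ
  NonVanishing f = ∀ r s t p → ¬ (f r s t p ≈ 0#)

  _≈Δ_ : {d : ℕ} → FunΔ d → FunΔ d → Set ℓ
  f ≈Δ g = ∀ r s t p → f r s t p ≈ g r s t p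

  D : (d : ℕ) → Matrix (suc d) → FunΔ d
  D d T r s t _ = det (suc ((d ∸ r) ∸ t)) (sub T t (d ∸ r))

module Submission where

-- T[t, d-r] is the square block of T of size s+1 in rows 0…s and columns
-- t…t+s.  The square of size x+1 at column t has corner (x , t+x), and all its
-- other entries come before the corner in row-major order.  Expanding along
-- the last row (corner lemma), changing the corner by δ changes the determinant
-- by δ · (determinant of the square of size x at column t).  So once the
-- smaller squares have nonzero determinant, the corner is determined by the
-- determinant (injectivity) and can be chosen to give any value (surjectivity).

open import Defs
open import Level using (Level; _⊔_)
open import Data.Nat using (ℕ)
open import Data.Product using (Σ; _×_; _,_)

open import Data.Nat using (zero; suc; s≤s; s≤s⁻¹; _∸_; _≤_; _<_; _≤?_; _<?_) renaming (_+_ to _+ℕ_)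
import Data.Nat.Properties as ℕ
open import Data.Nat.Induction using (<-rec)
open import Data.Fin using (Fin; toℕ; fromℕ; fromℕ<; inject₁; punchIn; punchOut) renaming (zero to fzero; suc to fsuc)
import Data.Fin.Properties as Fin
open import Data.Fin.Induction using (<-weakInduction)
open import Data.Product using (proj₁; proj₂)
open import Data.Sum using (_⊎_; inj₁; inj₂)
open import Data.Empty using (⊥-elim)
open import Function using (_∘_)
open import Data.Vec.Functional using (updateAt)
open import Data.Vec.Functional.Properties using (updateAt-updates; updateAt-minimal)
open import Relation.Nullary using (¬_; yes; no)
open import Relation.Binary.PropositionalEquality as ≡ using (_≡_; _≢_)


punchIn-punchOut-comm : ∀ {n} (j b : Fin (suc (suc n))) (j≢b : j ≢ b) (b≢j : b ≢ j) (y : Fin n) →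
  punchIn j (punchIn (punchOut j≢b) y) ≡ punchIn b (punchIn (punchOut b≢j) y)
punchIn-punchOut-comm fzero    fzero    j≢b b≢j y = ⊥-elim (j≢b ≡.refl)
punchIn-punchOut-comm fzero    (fsuc b) j≢b b≢j y = ≡.refl
punchIn-punchOut-comm (fsuc j) fzero    j≢b b≢j y = ≡.refl
punchIn-punchOut-comm {suc n} (fsuc j) (fsuc b) j≢b b≢j fzero    = ≡.refl
punchIn-punchOut-comm {suc n} (fsuc j) (fsuc b) j≢b b≢j (fsuc y) =
  ≡.cong fsuc (punchIn-punchOut-comm j b (j≢b ∘ ≡.cong fsuc) (b≢j ∘ ≡.cong fsuc) y)

private
  shift-adjacent : ∀ {p q r s} → p +ℕ q ≡ suc (r +ℕ s) → suc p +ℕ suc q ≡ suc (suc r +ℕ suc s)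
  shift-adjacent {p} {q} {r} {s} e =
    ≡.cong suc (≡.trans (ℕ.+-suc p q) (≡.cong suc (≡.trans e (≡.sym (ℕ.+-suc r s)))))

-- j + (the index of b once j is deleted) and b + (the index of j once b is
-- deleted) are adjacent numbers, so they carry opposite signs.
punchOut-adjacent : ∀ {n} (j b : Fin (suc n)) (j≢b : j ≢ b) (b≢j : b ≢ j) →
  toℕ j +ℕ toℕ (punchOut j≢b) ≡ suc (toℕ b +ℕ toℕ (punchOut b≢j))
  ⊎ toℕ b +ℕ toℕ (punchOut b≢j) ≡ suc (toℕ j +ℕ toℕ (punchOut j≢b))
punchOut-adjacent fzero fzero j≢b b≢j = ⊥-elim (j≢b ≡.refl)
punchOut-adjacent {suc n} fzero (fsuc b) j≢b b≢j = inj₂ (≡.cong suc (ℕ.+-identityʳ (toℕ b)))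
punchOut-adjacent {suc n} (fsuc j) fzero j≢b b≢j = inj₁ (≡.cong suc (ℕ.+-identityʳ (toℕ j)))
punchOut-adjacent {suc n} (fsuc j) (fsuc b) j≢b b≢j
  with punchOut-adjacent j b (j≢b ∘ ≡.cong fsuc) (b≢j ∘ ≡.cong fsuc)
... | inj₁ e = inj₁ (shift-adjacent e)
... | inj₂ e = inj₂ (shift-adjacent e)

punchIn-inject₁-self : ∀ {n} (k : Fin n) → punchIn (inject₁ k) k ≡ fsuc k
punchIn-inject₁-self fzero    = ≡.refl
punchIn-inject₁-self (fsuc k) = ≡.cong fsuc (punchIn-inject₁-self k)

punchIn-suc-self : ∀ {n} (k : Fin n) → punchIn (fsuc k) k ≡ inject₁ k
punchIn-suc-self fzero    = ≡.refl
punchIn-suc-self (fsuc k) = ≡.cong fsuc (punchIn-suc-self k)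

punchIn-inject₁≡punchIn-suc : ∀ {n} (k a : Fin n) → a ≢ k → punchIn (inject₁ k) a ≡ punchIn (fsuc k) a
punchIn-inject₁≡punchIn-suc fzero    fzero    a≢k = ⊥-elim (a≢k ≡.refl)
punchIn-inject₁≡punchIn-suc fzero    (fsuc a) a≢k = ≡.refl
punchIn-inject₁≡punchIn-suc (fsuc k) fzero    a≢k = ≡.refl
punchIn-inject₁≡punchIn-suc (fsuc k) (fsuc a) a≢k =
  ≡.cong fsuc (punchIn-inject₁≡punchIn-suc k a (a≢k ∘ ≡.cong fsuc))

punchIn-fromℕ : ∀ {n} (a : Fin n) → punchIn (fromℕ n) a ≡ inject₁ a
punchIn-fromℕ fzero    = ≡.refl
punchIn-fromℕ (fsuc a) = ≡.cong fsuc (punchIn-fromℕ a)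

≢fromℕ⇒< : ∀ {n} (i : Fin (suc n)) → i ≢ fromℕ n → toℕ i < n
≢fromℕ⇒< {n} i i≢n = ℕ.≤∧≢⇒< (s≤s⁻¹ (Fin.toℕ<n i))
  (λ i≡n → i≢n (Fin.toℕ-injective (≡.trans i≡n (≡.sym (Fin.toℕ-fromℕ n)))))

module Determinant {c ℓ : Level} (F : Field c ℓ) where

  open Field F
  open import Algebra.Properties.Ring ring
    using (-‿distribˡ-*; -‿distribʳ-*; -‿involutive; -0#≈0#; -‿+-comm; -1*x≈-x;
           +-inverseʳ-unique; //-rightDividesˡ; x≈y⇒x∙y⁻¹≈ε)
  open import Algebra.Properties.Semiring.Sum semiring
    using (sum; sum-cong-≋; sum-replicate-zero; sum-remove; ∑-distrib-+; ∑-comm; *-distribˡ-sum; *-distribʳ-sum)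
  open import Algebra.Properties.CommutativeSemigroup *-commutativeSemigroup using (x∙yz≈y∙xz)
  open import Relation.Binary.Reasoning.Setoid setoid

  Mat : ℕ → Set c
  Mat = Matrix F

  Row : ℕ → Set c
  Row n = Fin n → Carrier

  sign : ℕ → Carrier → Carrier
  sign = alt F

  Det : (n : ℕ) → Mat n → Carrier
  Det = det F

  minor : ∀ {n} → Fin (suc n) → Fin (suc n) → Mat (suc n) → Mat n
  minor i j A a b = A (punchIn i a) (punchIn j b)

  sign-cong : ∀ k {x y} → x ≈ y → sign k x ≈ sign k y
  sign-cong zero    p = p
  sign-cong (suc k) p = -‿cong (sign-cong k p)

  sign-+ : ∀ k x y → sign k (x + y) ≈ sign k x + sign k y
  sign-+ zero    x y = refl
  sign-+ (suc k) x y = trans (-‿cong (sign-+ k x y)) (sym (-‿+-comm _ _))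

  sign-*ˡ : ∀ k x y → sign k (x * y) ≈ x * sign k y
  sign-*ˡ zero    x y = refl
  sign-*ˡ (suc k) x y = trans (-‿cong (sign-*ˡ k x y)) (-‿distribʳ-* _ _)

  sign-*ʳ : ∀ k x y → sign k (x * y) ≈ sign k x * y
  sign-*ʳ zero    x y = refl
  sign-*ʳ (suc k) x y = trans (-‿cong (sign-*ʳ k x y)) (-‿distribˡ-* _ _)

  sign-0 : ∀ k → sign k 0# ≈ 0#
  sign-0 k = trans (sign-cong k (sym (zeroˡ 0#))) (trans (sign-*ʳ k 0# 0#) (zeroʳ _))

  sign-neg : ∀ k x → sign k (- x) ≈ - sign k x
  sign-neg zero    x = refl
  sign-neg (suc k) x = -‿cong (sign-neg k x)

  sign-add : ∀ m n x → sign (m +ℕ n) x ≡ sign m (sign n x)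
  sign-add zero    n x = ≡.refl
  sign-add (suc m) n x = ≡.cong -_ (sign-add m n x)

  sign-involutive : ∀ k x → sign k (sign k x) ≈ x
  sign-involutive zero    x = refl
  sign-involutive (suc k) x = begin
    - sign k (- sign k x) ≈⟨ -‿cong (sign-neg k _) ⟩
    - - sign k (sign k x) ≈⟨ -‿involutive _ ⟩
    sign k (sign k x)     ≈⟨ sign-involutive k x ⟩
    x                     ∎

  sign-zero-reflects : ∀ k {x} → sign k x ≈ 0# → x ≈ 0#
  sign-zero-reflects k {x} p = trans (sym (sign-involutive k x)) (trans (sign-cong k p) (sign-0 k))

  -- The sum Σᶠ defining det and matrix products is the library's finite sum,
  -- so the library's summation lemmas apply to both.
  Σᶠ≡sum : ∀ n (f : Row n) → Σᶠ F n f ≡ sum f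
  Σᶠ≡sum zero    f = ≡.refl
  Σᶠ≡sum (suc n) f = ≡.cong (f fzero +_) (Σᶠ≡sum n (f ∘ fsuc))

  sum-zero : ∀ {n} {f : Row n} → (∀ i → f i ≈ 0#) → sum f ≈ 0#
  sum-zero {n} p = trans (sum-cong-≋ p) (sum-replicate-zero n)

  sum-neg : ∀ {n} (f : Row n) → sum (λ i → - f i) ≈ - sum f
  sum-neg f = begin
    sum (λ i → - f i)      ≈⟨ sum-cong-≋ (λ i → sym (-1*x≈-x (f i))) ⟩
    sum (λ i → - 1# * f i) ≈⟨ *-distribˡ-sum (- 1#) f ⟨
    - 1# * sum f           ≈⟨ -1*x≈-x _ ⟩
    - sum f                ∎

  sum-sign : ∀ {n} k (f : Row n) → sum (λ i → sign k (f i)) ≈ sign k (sum f)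
  sum-sign zero    f = refl
  sum-sign (suc k) f = trans (sum-neg (λ i → sign k (f i))) (-‿cong (sum-sign k f))

  sum-single : ∀ {n} (k : Fin n) (f : Row n) → (∀ i → i ≢ k → f i ≈ 0#) → sum f ≈ f k
  sum-single {suc n} k f p = begin
    sum f                     ≈⟨ sum-remove {i = k} f ⟩
    f k + sum (f ∘ punchIn k) ≈⟨ +-congˡ (sum-zero (λ i → p (punchIn k i) (Fin.punchInᵢ≢i k i))) ⟩
    f k + 0#                  ≈⟨ +-identityʳ _ ⟩
    f k                       ∎

  cofactor : ∀ {n} (A : Mat (suc n)) → Fin (suc n) → Carrier
  cofactor {n} A j = sign (toℕ j) (A fzero j * Det n (minor fzero j A))

  det-expand : ∀ {n} (A : Mat (suc n)) → Det (suc n) A ≈ sum (cofactor A)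
  det-expand {n} A = reflexive (Σᶠ≡sum (suc n) (cofactor A))

  det-cong : ∀ n {A B : Mat n} → (∀ i j → A i j ≈ B i j) → Det n A ≈ Det n B
  det-cong zero    p = refl
  det-cong (suc n) {A} {B} p = begin
    Det (suc n) A   ≈⟨ det-expand A ⟩
    sum (cofactor A) ≈⟨ sum-cong-≋ (λ j → sign-cong (toℕ j)
                          (*-cong (p fzero j) (det-cong n (λ a b → p (fsuc a) (punchIn j b))))) ⟩
    sum (cofactor B) ≈⟨ det-expand B ⟨
    Det (suc n) B   ∎

  RowLinear : ∀ {n} → (Mat n → Carrier) → Set (c ⊔ ℓ)
  RowLinear {n} φ = ∀ (r : Fin n) (x : Carrier) (A B C : Mat n) →
    (∀ i j → i ≢ r → A i j ≈ B i j × A i j ≈ C i j) →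
    (∀ j → A r j ≈ x * B r j + C r j) →
    φ A ≈ x * φ B + φ C

  det-from-terms : ∀ {n} x (A B C : Mat (suc n)) →
    (∀ j → A fzero j * Det n (minor fzero j A)
         ≈ x * (B fzero j * Det n (minor fzero j B)) + C fzero j * Det n (minor fzero j C)) →
    Det (suc n) A ≈ x * Det (suc n) B + Det (suc n) C
  det-from-terms {n} x A B C terms = begin
    Det (suc n) A                                         ≈⟨ det-expand A ⟩
    sum (cofactor A)                                      ≈⟨ sum-cong-≋ split ⟩
    sum (λ j → x * cofactor B j + cofactor C j)           ≈⟨ ∑-distrib-+ (λ j → x * cofactor B j) (cofactor C) ⟩
    sum (λ j → x * cofactor B j) + sum (cofactor C)       ≈⟨ +-congʳ (*-distribˡ-sum x (cofactor B)) ⟨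
    x * sum (cofactor B) + sum (cofactor C)               ≈⟨ +-cong (*-congˡ (det-expand B)) (det-expand C) ⟨
    x * Det (suc n) B + Det (suc n) C                     ∎
    where
    split : ∀ j → cofactor A j ≈ x * cofactor B j + cofactor C j
    split j = trans (sign-cong (toℕ j) (terms j))
                    (trans (sign-+ (toℕ j) _ _) (+-congʳ (sign-*ˡ (toℕ j) x _)))

  -- the determinant is linear in each row: directly in the first row, and
  -- through the first-row minors in the other rows
  det-linear : ∀ n → RowLinear (Det n)
  det-linear (suc n) fzero x A B C off on = det-from-terms x A B C λ j → begin
    A fzero j * Det n (minor fzero j A)                     ≈⟨ *-cong (on j) (minorA≈B j) ⟩
    (x * B fzero j + C fzero j) * Det n (minor fzero j B)   ≈⟨ distribʳ _ _ _ ⟩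
    x * B fzero j * Det n (minor fzero j B) + C fzero j * Det n (minor fzero j B)
                                                            ≈⟨ +-cong (*-assoc _ _ _) (*-congˡ (minorB≈C j)) ⟩
    x * (B fzero j * Det n (minor fzero j B)) + C fzero j * Det n (minor fzero j C) ∎
    where
    minorA≈B : ∀ j → Det n (minor fzero j A) ≈ Det n (minor fzero j B)
    minorB≈C : ∀ j → Det n (minor fzero j B) ≈ Det n (minor fzero j C)
    minorA≈B j = det-cong n (λ a b → proj₁ (off (fsuc a) (punchIn j b) (λ ())))
    minorB≈C j = det-cong n (λ a b → trans (sym (proj₁ (off (fsuc a) (punchIn j b) (λ ()))))
                                            (proj₂ (off (fsuc a) (punchIn j b) (λ ()))))
  det-linear (suc n) (fsuc r) x A B C off on = det-from-terms x A B C λ j → begin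
    A fzero j * Det n (minor fzero j A)
      ≈⟨ *-cong (proj₁ (off fzero j (λ ()))) (det-linear n r x _ _ _
                  (λ a b a≢r → off (fsuc a) (punchIn j b) (a≢r ∘ Fin.suc-injective))
                  (λ b → on (punchIn j b))) ⟩
    B fzero j * (x * Det n (minor fzero j B) + Det n (minor fzero j C))
      ≈⟨ distribˡ _ _ _ ⟩
    B fzero j * (x * Det n (minor fzero j B)) + B fzero j * Det n (minor fzero j C)
      ≈⟨ +-cong (x∙yz≈y∙xz _ _ _) (*-congʳ (trans (sym (proj₁ (off fzero j (λ ())))) (proj₂ (off fzero j (λ ()))))) ⟩
    x * (B fzero j * Det n (minor fzero j B)) + C fzero j * Det n (minor fzero j C) ∎

  sign-adjacent : ∀ {m k} → (m ≡ suc k ⊎ k ≡ suc m) → ∀ x → sign m x ≈ - sign k x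
  sign-adjacent (inj₁ ≡.refl) x = refl
  sign-adjacent (inj₂ ≡.refl) x = sym (-‿involutive _)

  -- an antisymmetric square array with zero diagonal sums to zero
  -- (by peeling off the first row and column; valid in every characteristic)
  sum-antisymmetric : ∀ n (K : Fin n → Fin n → Carrier) →
    (∀ i → K i i ≈ 0#) → (∀ i j → K i j ≈ - K j i) → sum (λ i → sum (K i)) ≈ 0#
  sum-antisymmetric zero    K diag anti = refl
  sum-antisymmetric (suc n) K diag anti = begin
    (K fzero fzero + X) + sum (λ i → K (fsuc i) fzero + sum (λ j → K (fsuc i) (fsuc j)))
      ≈⟨ +-cong (+-congʳ (diag fzero)) (∑-distrib-+ (λ i → K (fsuc i) fzero) inner) ⟩
    (0# + X) + (sum (λ i → K (fsuc i) fzero) + sum inner)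
      ≈⟨ +-cong (+-identityˡ X) (+-cong column
           (sum-antisymmetric n (λ i j → K (fsuc i) (fsuc j)) (diag ∘ fsuc) (λ i j → anti (fsuc i) (fsuc j)))) ⟩
    X + (- X + 0#) ≈⟨ +-congˡ (+-identityʳ (- X)) ⟩
    X + - X        ≈⟨ -‿inverseʳ X ⟩
    0#             ∎
    where
    X : Carrier
    X = sum (λ j → K fzero (fsuc j))
    inner : Row n
    inner i = sum (λ j → K (fsuc i) (fsuc j))
    column : sum (λ i → K (fsuc i) fzero) ≈ - X
    column = trans (sum-cong-≋ (λ i → anti (fsuc i) fzero)) (sum-neg (λ j → K fzero (fsuc j)))

  -- A determinant whose first two rows agree vanishes: expanding along both
  -- rows gives a double sum over column pairs (j , b) whose terms are
  -- antisymmetric in (j , b).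
  module EqualTopRows {n : ℕ} (A : Mat (suc (suc n))) (top : ∀ j → A fzero j ≈ A (fsuc fzero) j) where

    u : Row (suc (suc n))
    u = A fzero

    E : Fin (suc (suc n)) → Fin (suc n) → Carrier
    E j k = Det n (minor fzero k (minor fzero j A))

    S : Fin (suc (suc n)) → Fin (suc (suc n)) → Carrier
    S j b with j Fin.≟ b
    ... | yes _   = 0#
    ... | no j≢b = sign (toℕ j +ℕ toℕ (punchOut j≢b)) (E j (punchOut j≢b))

    K : Fin (suc (suc n)) → Fin (suc (suc n)) → Carrier
    K j b = u j * (u b * S j b)

    S-diagonal : ∀ j → S j j ≈ 0#
    S-diagonal j with j Fin.≟ j
    ... | yes _  = refl
    ... | no j≢j = ⊥-elim (j≢j ≡.refl)

    S-antisymmetric : ∀ j b → S j b ≈ - S b j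
    S-antisymmetric j b with j Fin.≟ b | b Fin.≟ j
    ... | yes _   | yes _   = sym -0#≈0#
    ... | yes j≡b | no b≢j = ⊥-elim (b≢j (≡.sym j≡b))
    ... | no j≢b | yes b≡j = ⊥-elim (j≢b (≡.sym b≡j))
    ... | no j≢b | no b≢j =
      trans (sign-cong (toℕ j +ℕ toℕ (punchOut j≢b)) same-minor)
            (sign-adjacent (punchOut-adjacent j b j≢b b≢j) _)
      where
      same-minor : E j (punchOut j≢b) ≈ E b (punchOut b≢j)
      same-minor = det-cong n (λ a y → reflexive (≡.cong (A (fsuc (fsuc a))) (punchIn-punchOut-comm j b j≢b b≢j y)))

    S-punchIn : ∀ j k → S j (punchIn j k) ≈ sign (toℕ j +ℕ toℕ k) (E j k)
    S-punchIn j k with j Fin.≟ punchIn j k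
    ... | yes j≡jk = ⊥-elim (Fin.punchInᵢ≢i j k (≡.sym j≡jk))
    ... | no j≢jk = reflexive (≡.cong (λ z → sign (toℕ j +ℕ toℕ z) (E j z))
                                      (≡.trans (Fin.punchOut-cong j ≡.refl) (Fin.punchOut-punchIn j)))

    K-diagonal : ∀ j → K j j ≈ 0#
    K-diagonal j = trans (*-congˡ (trans (*-congˡ (S-diagonal j)) (zeroʳ _))) (zeroʳ _)

    K-antisymmetric : ∀ j b → K j b ≈ - K b j
    K-antisymmetric j b = begin
      u j * (u b * S j b)     ≈⟨ *-congˡ (*-congˡ (S-antisymmetric j b)) ⟩
      u j * (u b * - S b j)   ≈⟨ *-congˡ (-‿distribʳ-* _ _) ⟨
      u j * - (u b * S b j)   ≈⟨ -‿distribʳ-* _ _ ⟨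
      - (u j * (u b * S b j)) ≈⟨ -‿cong (x∙yz≈y∙xz (u j) (u b) (S b j)) ⟩
      - (u b * (u j * S b j)) ∎

    cofactor≈row : ∀ j → cofactor A j ≈ sum (K j)
    cofactor≈row j = begin
      sign (toℕ j) (u j * Det (suc n) M)               ≈⟨ sign-cong (toℕ j) (*-congˡ (det-expand M)) ⟩
      sign (toℕ j) (u j * sum (cofactor M))            ≈⟨ sign-*ˡ (toℕ j) _ _ ⟩
      u j * sign (toℕ j) (sum (cofactor M))            ≈⟨ *-congˡ (sum-sign (toℕ j) (cofactor M)) ⟨
      u j * sum (λ k → sign (toℕ j) (cofactor M k))    ≈⟨ *-distribˡ-sum (u j) (λ k → sign (toℕ j) (cofactor M k)) ⟩
      sum (λ k → u j * sign (toℕ j) (cofactor M k))    ≈⟨ sum-cong-≋ term ⟩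
      sum (λ k → K j (punchIn j k))                    ≈⟨ +-identityˡ _ ⟨
      0# + sum (λ k → K j (punchIn j k))               ≈⟨ +-congʳ (K-diagonal j) ⟨
      K j j + sum (λ k → K j (punchIn j k))            ≈⟨ sum-remove {i = j} (K j) ⟨
      sum (K j)                                        ∎
      where
      M : Mat (suc n)
      M = minor fzero j A
      term : ∀ k → u j * sign (toℕ j) (cofactor M k) ≈ K j (punchIn j k)
      term k = *-congˡ (begin
        sign (toℕ j) (sign (toℕ k) (M fzero k * E j k)) ≈⟨ reflexive (≡.sym (sign-add (toℕ j) (toℕ k) _)) ⟩
        sign (toℕ j +ℕ toℕ k) (M fzero k * E j k)       ≈⟨ sign-*ˡ (toℕ j +ℕ toℕ k) _ _ ⟩
        M fzero k * sign (toℕ j +ℕ toℕ k) (E j k)       ≈⟨ *-cong (sym (top (punchIn j k))) (sym (S-punchIn j k)) ⟩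
        u (punchIn j k) * S j (punchIn j k)             ∎)

    vanish : Det (suc (suc n)) A ≈ 0#
    vanish = begin
      Det (suc (suc n)) A          ≈⟨ det-expand A ⟩
      sum (cofactor A)             ≈⟨ sum-cong-≋ cofactor≈row ⟩
      sum (λ j → sum (K j))        ≈⟨ sum-antisymmetric (suc (suc n)) K K-diagonal K-antisymmetric ⟩
      0#                           ∎

  det-adjacent : ∀ n (r : Fin (suc n)) (A : Mat (suc (suc n))) →
    (∀ j → A (inject₁ r) j ≈ A (fsuc r) j) → Det (suc (suc n)) A ≈ 0#
  det-adjacent n       fzero    A same = EqualTopRows.vanish A same
  det-adjacent (suc n) (fsuc r) A same = trans (det-expand A) (sum-zero {f = cofactor A} λ j →
    trans (sign-cong (toℕ j) (trans (*-congˡ (det-adjacent n r (minor fzero j A) (same ∘ punchIn j))) (zeroʳ _)))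
          (sign-0 (toℕ j)))

  record Alternating {n : ℕ} (φ : Mat n → Carrier) : Set (c ⊔ ℓ) where
    field
      cong     : ∀ {A B} → (∀ i j → A i j ≈ B i j) → φ A ≈ φ B
      linear   : RowLinear φ
      adjacent : ∀ (r s : Fin n) (A : Mat n) → toℕ s ≡ suc (toℕ r) → (∀ j → A r j ≈ A s j) → φ A ≈ 0#

  det-alternating : ∀ n → Alternating (Det n)
  det-alternating n = record { cong = det-cong n ; linear = det-linear n ; adjacent = adjacent n }
    where
    adjacent : ∀ n (r s : Fin n) (A : Mat n) → toℕ s ≡ suc (toℕ r) → (∀ j → A r j ≈ A s j) → Det n A ≈ 0#
    adjacent (suc zero)    fzero fzero    A () same
    adjacent (suc (suc m)) r     (fsuc s) A s≡r+1 same
      with Fin.toℕ-injective {i = r} {j = inject₁ s} (≡.trans (ℕ.suc-injective (≡.sym s≡r+1)) (≡.sym (Fin.toℕ-inject₁ s)))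
    ... | ≡.refl = det-adjacent m s A same

  setRow : ∀ {n} → Fin n → Row n → Mat n → Mat n
  setRow r v A = updateAt A r (λ _ → v)

  setRow-hit : ∀ {n} (r : Fin n) v A j → setRow r v A r j ≈ v j
  setRow-hit r v A j = reflexive (≡.cong-app (updateAt-updates r A) j)

  setRow-miss : ∀ {n} {r i : Fin n} v A → i ≢ r → ∀ j → setRow r v A i j ≈ A i j
  setRow-miss {r = r} {i} v A i≢r j = reflexive (≡.cong-app (updateAt-minimal i r A i≢r) j)

  setRows : ∀ {n} → Fin n → Row n → Fin n → Row n → Mat n → Mat n
  setRows p v q w A = setRow q w (setRow p v A)

  setRows-p : ∀ {n} (p q : Fin n) v w A → p ≢ q → ∀ j → setRows p v q w A p j ≈ v j
  setRows-p p q v w A p≢q j = trans (setRow-miss w _ p≢q j) (setRow-hit p v A j)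

  setRows-q : ∀ {n} (p q : Fin n) v w A → ∀ j → setRows p v q w A q j ≈ w j
  setRows-q p q v w A j = setRow-hit q w _ j

  setRows-other : ∀ {n} (p q : Fin n) {i} v w A → i ≢ p → i ≢ q → ∀ j → setRows p v q w A i j ≈ A i j
  setRows-other p q v w A i≢p i≢q j = trans (setRow-miss w _ i≢q j) (setRow-miss v A i≢p j)

  swapRows : ∀ {n} → Fin n → Fin n → Mat n → Mat n
  swapRows p q A = setRows p (A q) q (A p) A

  -- Polarization: if φ vanishes whenever rows p and q agree, then swapping
  -- rows p and q negates φ.
  swap-negates : ∀ {n} {φ : Mat n → Carrier} → Alternating φ → (p q : Fin n) → p ≢ q →
    (∀ B → (∀ j → B p j ≈ B q j) → φ B ≈ 0#) → ∀ A → φ (swapRows p q A) ≈ - φ A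
  swap-negates {n} {φ} alt p q p≢q vanish A = +-inverseʳ-unique (φ A) _ (begin
    φ A + φ (X b a)                                   ≈⟨ +-congʳ (cong X-A) ⟨
    φ (X a b) + φ (X b a)                             ≈⟨ +-cong (+-identityˡ _) (+-identityʳ _) ⟨
    (0# + φ (X a b)) + (φ (X b a) + 0#)               ≈⟨ +-cong (+-congʳ (equal a)) (+-congˡ (equal b)) ⟨
    (φ (X a a) + φ (X a b)) + (φ (X b a) + φ (X b b)) ≈⟨ +-cong (additive-q a) (additive-q b) ⟨
    φ (X a (a ⊕ b)) + φ (X b (a ⊕ b))                 ≈⟨ additive-p (a ⊕ b) ⟨
    φ (X (a ⊕ b) (a ⊕ b))                             ≈⟨ equal (a ⊕ b) ⟩
    0#                                                ∎)
    where
    open Alternating alt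
    a b : Row n
    a = A p
    b = A q
    _⊕_ : Row n → Row n → Row n
    (v ⊕ w) j = v j + w j
    X : Row n → Row n → Mat n
    X v w = setRows p v q w A

    equal : ∀ v → φ (X v v) ≈ 0#
    equal v = vanish (X v v) (λ j → trans (setRows-p p q v v A p≢q j) (sym (setRows-q p q v v A j)))

    X-A : ∀ i j → X a b i j ≈ A i j
    X-A i j with i Fin.≟ p | i Fin.≟ q
    ... | yes ≡.refl | _          = setRows-p p q a b A p≢q j
    ... | no _       | yes ≡.refl = setRows-q p q a b A j
    ... | no i≢p     | no i≢q     = setRows-other p q a b A i≢p i≢q j

    additive : ∀ r (C D E : Mat n) → (∀ i j → i ≢ r → C i j ≈ D i j × C i j ≈ E i j) →
      (∀ j → C r j ≈ D r j + E r j) → φ C ≈ φ D + φ E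
    additive r C D E off on =
      trans (linear r 1# C D E off (λ j → trans (on j) (+-congʳ (sym (*-identityˡ _))))) (+-congʳ (*-identityˡ _))

    off-p : ∀ v v′ w i j → i ≢ p → X v w i j ≈ X v′ w i j
    off-p v v′ w i j i≢p with i Fin.≟ q
    ... | yes ≡.refl = trans (setRows-q p q v w A j) (sym (setRows-q p q v′ w A j))
    ... | no i≢q     = trans (setRows-other p q v w A i≢p i≢q j) (sym (setRows-other p q v′ w A i≢p i≢q j))

    off-q : ∀ v w w′ i j → i ≢ q → X v w i j ≈ X v w′ i j
    off-q v w w′ i j i≢q with i Fin.≟ p
    ... | yes ≡.refl = trans (setRows-p p q v w A p≢q j) (sym (setRows-p p q v w′ A p≢q j))
    ... | no i≢p     = trans (setRows-other p q v w A i≢p i≢q j) (sym (setRows-other p q v w′ A i≢p i≢q j))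

    additive-p : ∀ w → φ (X (a ⊕ b) w) ≈ φ (X a w) + φ (X b w)
    additive-p w = additive p _ _ _ (λ i j i≢p → off-p _ a w i j i≢p , off-p _ b w i j i≢p)
      (λ j → trans (setRows-p p q _ w A p≢q j) (sym (+-cong (setRows-p p q a w A p≢q j) (setRows-p p q b w A p≢q j))))

    additive-q : ∀ v → φ (X v (a ⊕ b)) ≈ φ (X v a) + φ (X v b)
    additive-q v = additive q _ _ _ (λ i j i≢q → off-q v _ a i j i≢q , off-q v _ b i j i≢q)
      (λ j → trans (setRows-q p q v _ A j) (sym (+-cong (setRows-q p q v a A j) (setRows-q p q v b A j))))

  -- rows 0 and a + 1 agree: move row a + 1 up by adjacent swaps
  top-equal⇒zero : ∀ {n} {φ : Mat (suc n) → Carrier} → Alternating φ → (a : Fin n) (A : Mat (suc n)) →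
    (∀ j → A fzero j ≈ A (fsuc a) j) → φ A ≈ 0#
  top-equal⇒zero {suc n} {φ} alt = <-weakInduction P base step
    where
    open Alternating alt
    P : Fin (suc n) → Set (c ⊔ ℓ)
    P a = ∀ A → (∀ j → A fzero j ≈ A (fsuc a) j) → φ A ≈ 0#

    base : P fzero
    base A same = adjacent fzero (fsuc fzero) A ≡.refl same

    step : ∀ a → P (inject₁ a) → P (fsuc a)
    step a ih A same = begin
      φ A                   ≈⟨ -‿involutive _ ⟨
      - - φ A               ≈⟨ -‿cong (swap-negates alt p q p≢q (λ B → adjacent p q B q≡p+1) A) ⟨
      - φ (swapRows p q A)  ≈⟨ -‿cong (ih (swapRows p q A) moved) ⟩
      - 0#                  ≈⟨ -0#≈0# ⟩
      0#                    ∎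
      where
      p q : Fin (suc (suc n))
      p = fsuc (inject₁ a)
      q = fsuc (fsuc a)
      q≡p+1 : toℕ q ≡ suc (toℕ p)
      q≡p+1 = ≡.cong (suc ∘ suc) (≡.sym (Fin.toℕ-inject₁ a))
      p≢q : p ≢ q
      p≢q p≡q = ℕ.1+n≢n (≡.sym (≡.trans (≡.cong toℕ p≡q) q≡p+1))
      moved : ∀ j → swapRows p q A fzero j ≈ swapRows p q A p j
      moved j = trans (setRows-other p q (A q) (A p) A (λ ()) (λ ()) j)
                      (trans (same j) (sym (setRows-p p q (A q) (A p) A p≢q j)))

  rotate : ∀ {n} → Fin (suc n) → Mat (suc n) → Mat (suc n)
  rotate k A fzero    = A k
  rotate k A (fsuc a) = A (punchIn k a)

  rotate-sign : ∀ {n} {φ : Mat (suc n) → Carrier} → Alternating φ → (k : Fin (suc n)) (A : Mat (suc n)) →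
    φ (rotate k A) ≈ sign (toℕ k) (φ A)
  rotate-sign {n} {φ} alt = <-weakInduction P base step
    where
    open Alternating alt
    P : Fin (suc n) → Set (c ⊔ ℓ)
    P k = ∀ A → φ (rotate k A) ≈ sign (toℕ k) (φ A)

    base : P fzero
    base A = cong λ { fzero j → refl ; (fsuc a) j → refl }

    step : ∀ k → P (inject₁ k) → P (fsuc k)
    step k ih A = begin
      φ (rotate (fsuc k) A)          ≈⟨ cong rotate-swap ⟩
      φ (swapRows fzero (fsuc k) R)  ≈⟨ swap-negates alt fzero (fsuc k) (λ ()) (top-equal⇒zero alt k) R ⟩
      - φ R                          ≈⟨ -‿cong (ih A) ⟩
      - sign (toℕ (inject₁ k)) (φ A) ≈⟨ reflexive (≡.cong (λ m → - sign m (φ A)) (Fin.toℕ-inject₁ k)) ⟩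
      sign (suc (toℕ k)) (φ A)       ∎
      where
      R : Mat (suc n)
      R = rotate (inject₁ k) A
      rotate-swap : ∀ i j → rotate (fsuc k) A i j ≈ swapRows fzero (fsuc k) R i j
      rotate-swap fzero j = trans (reflexive (≡.cong (λ z → A z j) (≡.sym (punchIn-inject₁-self k))))
                                  (sym (setRows-p fzero (fsuc k) (R (fsuc k)) (R fzero) R (λ ()) j))
      rotate-swap (fsuc a) j with a Fin.≟ k
      ... | yes ≡.refl = trans (reflexive (≡.cong (λ z → A z j) (punchIn-suc-self a)))
                               (sym (setRows-q fzero (fsuc k) (R (fsuc a)) (R fzero) R j))
      ... | no a≢k     = trans (reflexive (≡.cong (λ z → A z j) (≡.sym (punchIn-inject₁≡punchIn-suc k a a≢k))))
                               (sym (setRows-other fzero (fsuc k) (R (fsuc k)) (R fzero) R (λ ()) (a≢k ∘ Fin.suc-injective) j))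

  equal-rows⇒zero : ∀ {n} {φ : Mat (suc n) → Carrier} → Alternating φ → (k i : Fin (suc n)) (A : Mat (suc n)) →
    k ≢ i → (∀ j → A k j ≈ A i j) → φ A ≈ 0#
  equal-rows⇒zero alt k i A k≢i same = sign-zero-reflects (toℕ k) (trans (sym (rotate-sign alt k A))
    (top-equal⇒zero alt (punchOut k≢i) (rotate k A)
      (λ j → trans (same j) (reflexive (≡.cong (λ z → A z j) (≡.sym (Fin.punchIn-punchOut k≢i)))))))

  add-row-multiple : ∀ {n} {φ : Mat (suc n) → Carrier} → Alternating φ → (p q : Fin (suc n)) → p ≢ q →
    (x : Carrier) (A B : Mat (suc n)) →
    (∀ i j → i ≢ q → B i j ≈ A i j) → (∀ j → B q j ≈ x * A p j + A q j) → φ B ≈ φ A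
  add-row-multiple {φ = φ} alt p q p≢q x A B off on = begin
    φ B           ≈⟨ linear q x B Z A (λ i j i≢q → trans (off i j i≢q) (sym (setRow-miss (A p) A i≢q j)) , off i j i≢q)
                                      (λ j → trans (on j) (+-congʳ (*-congˡ (sym (setRow-hit q (A p) A j))))) ⟩
    x * φ Z + φ A ≈⟨ +-congʳ (trans (*-congˡ Z≈0) (zeroʳ x)) ⟩
    0# + φ A      ≈⟨ +-identityˡ _ ⟩
    φ A           ∎
    where
    open Alternating alt
    Z : Mat _
    Z = setRow q (A p) A
    Z≈0 : φ Z ≈ 0#
    Z≈0 = equal-rows⇒zero alt p q Z p≢q (λ j → trans (setRow-miss (A p) A p≢q j) (sym (setRow-hit q (A p) A j)))

  linear-sum : ∀ {n} {φ : Mat n → Carrier} → Alternating φ →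
    ∀ m (r : Fin n) (xs : Fin m → Carrier) (vs : Fin m → Row n) (A : Mat n) →
    (∀ j → A r j ≈ sum (λ a → xs a * vs a j)) → φ A ≈ sum (λ a → xs a * φ (setRow r (vs a) A))
  linear-sum {φ = φ} alt zero r xs vs A on = begin
    φ A              ≈⟨ linear r (- 1#) A A A (λ _ _ _ → refl , refl) (λ j → trans (on j) (sym (cancel (A r j)))) ⟩
    - 1# * φ A + φ A ≈⟨ cancel (φ A) ⟩
    0#               ∎
    where
    open Alternating alt
    cancel : ∀ x → - 1# * x + x ≈ 0#
    cancel x = trans (+-congʳ (-1*x≈-x x)) (-‿inverseˡ x)
  linear-sum {n} {φ} alt (suc m) r xs vs A on = begin
    φ A
      ≈⟨ linear r (xs fzero) A (setRow r (vs fzero) A) A′ off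
           (λ j → trans (on j) (+-cong (*-congˡ (sym (setRow-hit r (vs fzero) A j))) (sym (setRow-hit r rest A j)))) ⟩
    xs fzero * φ (setRow r (vs fzero) A) + φ A′
      ≈⟨ +-congˡ (linear-sum alt m r (xs ∘ fsuc) (vs ∘ fsuc) A′ (setRow-hit r rest A)) ⟩
    xs fzero * φ (setRow r (vs fzero) A) + sum (λ a → xs (fsuc a) * φ (setRow r (vs (fsuc a)) A′))
      ≈⟨ +-congˡ (sum-cong-≋ (λ a → *-congˡ (cong (setRow-twice (vs (fsuc a)))))) ⟩
    xs fzero * φ (setRow r (vs fzero) A) + sum (λ a → xs (fsuc a) * φ (setRow r (vs (fsuc a)) A)) ∎
    where
    open Alternating alt
    rest : Row n
    rest j = sum (λ a → xs (fsuc a) * vs (fsuc a) j)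
    A′ : Mat n
    A′ = setRow r rest A
    off : ∀ i j → i ≢ r → A i j ≈ setRow r (vs fzero) A i j × A i j ≈ A′ i j
    off i j i≢r = sym (setRow-miss (vs fzero) A i≢r j) , sym (setRow-miss rest A i≢r j)
    setRow-twice : ∀ v i j → setRow r v A′ i j ≈ setRow r v A i j
    setRow-twice v i j with i Fin.≟ r
    ... | yes ≡.refl = trans (setRow-hit r v A′ j) (sym (setRow-hit r v A j))
    ... | no i≢r     = trans (setRow-miss v A′ i≢r j)
                             (trans (setRow-miss rest A i≢r j) (sym (setRow-miss v A i≢r j)))

  Id : ∀ {n} → Mat n
  Id = I F

  Id-diagonal : ∀ {n} (i : Fin n) → Id i i ≈ 1#
  Id-diagonal i with i Fin.≟ i
  ... | yes _  = refl
  ... | no i≢i = ⊥-elim (i≢i ≡.refl)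

  Id-off : ∀ {n} {i j : Fin n} → i ≢ j → Id i j ≈ 0#
  Id-off {i = i} {j} i≢j with i Fin.≟ j
  ... | yes i≡j = ⊥-elim (i≢j i≡j)
  ... | no _    = refl

  Id-resp : ∀ {m n} {i j : Fin m} {i′ j′ : Fin n} → (i ≡ j → i′ ≡ j′) → (i′ ≡ j′ → i ≡ j) → Id i j ≈ Id i′ j′
  Id-resp {i = i} {j} {i′} {j′} to from with i Fin.≟ j | i′ Fin.≟ j′
  ... | yes _   | yes _    = refl
  ... | yes i≡j | no i′≢j′ = ⊥-elim (i′≢j′ (to i≡j))
  ... | no i≢j  | yes i′≡j′ = ⊥-elim (i≢j (from i′≡j′))
  ... | no _    | no _     = refl

  sum-Id-right : ∀ {n} (x : Row n) k → sum (λ j → x j * Id j k) ≈ x k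
  sum-Id-right x k = trans (sum-single k _ (λ i i≢k → trans (*-congˡ (Id-off i≢k)) (zeroʳ (x i))))
                           (trans (*-congˡ (Id-diagonal k)) (*-identityʳ (x k)))

  sum-Id-left : ∀ {n} (x : Row n) k → sum (λ j → Id k j * x j) ≈ x k
  sum-Id-left x k = trans (sum-single k _ (λ i i≢k → trans (*-congʳ (Id-off (i≢k ∘ ≡.sym))) (zeroˡ (x i))))
                          (trans (*-congʳ (Id-diagonal k)) (*-identityˡ (x k)))

  -- If the first rows of B and B′ are both the unit row e_j and their lower
  -- rows agree outside column j, then φ B = φ B′: the column-j entry of each
  -- lower row is changed by adding a multiple of the first row, one row at a
  -- time along the hybrids below.
  module ClearColumn {n : ℕ} {φ : Mat (suc n) → Carrier} (alt : Alternating φ) (j : Fin (suc n))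
    (B B′ : Mat (suc n)) (top : ∀ c → B fzero c ≈ Id j c) (top′ : ∀ c → B′ fzero c ≈ Id j c)
    (lower : ∀ a c → c ≢ j → B (fsuc a) c ≈ B′ (fsuc a) c) where

    open Alternating alt

    hybrid : ℕ → Mat (suc n)
    hybrid k fzero = B fzero
    hybrid k (fsuc a) with toℕ a <? k
    ... | yes _ = B′ (fsuc a)
    ... | no  _ = B (fsuc a)

    hybrid-start : ∀ i c → hybrid 0 i c ≈ B i c
    hybrid-start fzero    c = refl
    hybrid-start (fsuc a) c with toℕ a <? 0
    ... | no _ = refl

    hybrid-end : ∀ i c → hybrid n i c ≈ B′ i c
    hybrid-end fzero    c = trans (top c) (sym (top′ c))
    hybrid-end (fsuc a) c with toℕ a <? n
    ... | yes _  = refl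
    ... | no a≮n = ⊥-elim (a≮n (Fin.toℕ<n a))

    hybrid-other : ∀ k a c → toℕ a ≢ k → hybrid (suc k) (fsuc a) c ≈ hybrid k (fsuc a) c
    hybrid-other k a c a≢k with toℕ a <? suc k | toℕ a <? k
    ... | yes _   | yes _   = refl
    ... | no _    | no _    = refl
    ... | yes a<1+k | no a≮k = ⊥-elim (a≢k (ℕ.≤-antisym (s≤s⁻¹ a<1+k) (ℕ.≮⇒≥ a≮k)))
    ... | no a≮1+k | yes a<k = ⊥-elim (a≮1+k (ℕ.m<n⇒m<1+n a<k))

    hybrid-new : ∀ k a c → toℕ a ≡ k → hybrid (suc k) (fsuc a) c ≈ B′ (fsuc a) c × hybrid k (fsuc a) c ≈ B (fsuc a) c
    hybrid-new k a c a≡k with toℕ a <? suc k | toℕ a <? k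
    ... | yes _    | no _    = refl , refl
    ... | no a≮1+k | _       = ⊥-elim (a≮1+k (s≤s (ℕ.≤-reflexive a≡k)))
    ... | yes _    | yes a<k = ⊥-elim (ℕ.<-irrefl a≡k a<k)

    decompose : ∀ a c → B′ (fsuc a) c ≈ (B′ (fsuc a) j + - B (fsuc a) j) * Id j c + B (fsuc a) c
    decompose a c with j Fin.≟ c
    ... | yes ≡.refl = sym (trans (+-congʳ (*-identityʳ _)) (//-rightDividesˡ (B (fsuc a) j) (B′ (fsuc a) j)))
    ... | no j≢c     = sym (trans (+-congʳ (zeroʳ _)) (trans (+-identityˡ _) (lower a c (j≢c ∘ ≡.sym))))

    hybrid-step : ∀ k → φ (hybrid (suc k)) ≈ φ (hybrid k)
    hybrid-step k with k <? n
    ... | no k≮n = cong λ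
      { fzero c → refl
      ; (fsuc a) c → hybrid-other k a c (λ a≡k → k≮n (≡.subst (_< n) a≡k (Fin.toℕ<n a))) }
    ... | yes k<n = add-row-multiple alt fzero (fsuc a₀) (λ ()) (B′ (fsuc a₀) j + - B (fsuc a₀) j)
                      (hybrid k) (hybrid (suc k)) off on
      where
      a₀ : Fin n
      a₀ = fromℕ< k<n
      a₀≡k : toℕ a₀ ≡ k
      a₀≡k = Fin.toℕ-fromℕ< k<n
      off : ∀ i c → i ≢ fsuc a₀ → hybrid (suc k) i c ≈ hybrid k i c
      off fzero    c _    = refl
      off (fsuc a) c a≢a₀ = hybrid-other k a c (λ a≡k → a≢a₀ (≡.cong fsuc (Fin.toℕ-injective (≡.trans a≡k (≡.sym a₀≡k)))))
      on : ∀ c → hybrid (suc k) (fsuc a₀) c ≈ (B′ (fsuc a₀) j + - B (fsuc a₀) j) * hybrid k fzero c + hybrid k (fsuc a₀) c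
      on c = trans (proj₁ (hybrid-new k a₀ c a₀≡k))
                   (trans (decompose a₀ c) (+-cong (*-congˡ (sym (top c))) (sym (proj₂ (hybrid-new k a₀ c a₀≡k)))))

    hybrid-invariant : ∀ k → φ (hybrid k) ≈ φ B
    hybrid-invariant zero    = cong hybrid-start
    hybrid-invariant (suc k) = trans (hybrid-step k) (hybrid-invariant k)

    cleared : φ B ≈ φ B′
    cleared = trans (sym (hybrid-invariant n)) (cong hybrid-end)

  insertZero : ∀ {n} → Fin (suc n) → Row n → Row (suc n)
  insertZero j v c with j Fin.≟ c
  ... | yes _   = 0#
  ... | no j≢c = v (punchOut j≢c)

  insertZero-cong : ∀ {n} (j : Fin (suc n)) {v w : Row n} → (∀ b → v b ≈ w b) → ∀ c → insertZero j v c ≈ insertZero j w c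
  insertZero-cong j v≈w c with j Fin.≟ c
  ... | yes _   = refl
  ... | no j≢c = v≈w (punchOut j≢c)

  insertZero-linear : ∀ {n} (j : Fin (suc n)) x (v w z : Row n) → (∀ b → v b ≈ x * w b + z b) →
    ∀ c → insertZero j v c ≈ x * insertZero j w c + insertZero j z c
  insertZero-linear j x v w z v≈ c with j Fin.≟ c
  ... | yes _   = sym (trans (+-congʳ (zeroʳ x)) (+-identityʳ 0#))
  ... | no j≢c = v≈ (punchOut j≢c)

  embed : ∀ {n} → Fin (suc n) → Mat n → Mat (suc n)
  embed j X fzero    = Id j
  embed j X (fsuc a) = insertZero j (X a)

  embed-alternating : ∀ {n} {φ : Mat (suc n) → Carrier} → Alternating φ → ∀ j → Alternating (φ ∘ embed j)
  embed-alternating {φ = φ} alt j = record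
    { cong     = λ X≈Y → cong λ { fzero c → refl ; (fsuc a) c → insertZero-cong j (X≈Y a) c }
    ; linear   = λ r x A B C off on → linear (fsuc r) x (embed j A) (embed j B) (embed j C)
        (λ { fzero c _ → refl , refl
           ; (fsuc a) c a≢r → insertZero-cong j (λ b → proj₁ (off a b (a≢r ∘ ≡.cong fsuc))) c
                            , insertZero-cong j (λ b → proj₂ (off a b (a≢r ∘ ≡.cong fsuc))) c })
        (insertZero-linear j x (A r) (B r) (C r) on)
    ; adjacent = λ r s A s≡r+1 same → adjacent (fsuc r) (fsuc s) (embed j A) (≡.cong suc s≡r+1) (insertZero-cong j same)
    }
    where open Alternating alt

  embed-Id : ∀ {n} (j : Fin (suc n)) i c → embed j Id i c ≈ rotate j Id i c
  embed-Id j fzero    c = refl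
  embed-Id j (fsuc a) c with j Fin.≟ c
  ... | yes ≡.refl = sym (Id-off (Fin.punchInᵢ≢i j a))
  ... | no j≢c     = Id-resp (λ a≡c′ → ≡.trans (≡.cong (punchIn j) a≡c′) (Fin.punchIn-punchOut j≢c))
                             (λ ja≡c → Fin.punchIn-injective j a (punchOut j≢c) (≡.trans ja≡c (≡.sym (Fin.punchIn-punchOut j≢c))))

  -- Expand the first row in unit rows; with first row e_j, φ only sees the
  -- minor of A at (0 , j), on which it is again alternating multilinear.
  uniqueness : ∀ n {φ : Mat n → Carrier} → Alternating φ → ∀ A → φ A ≈ Det n A * φ Id
  uniqueness zero    alt A = trans (Alternating.cong alt (λ ())) (sym (*-identityˡ _))
  uniqueness (suc n) {φ} alt A = begin
    φ A
      ≈⟨ linear-sum alt (suc n) fzero (A fzero) Id A (λ c → sym (sum-Id-right (A fzero) c)) ⟩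
    sum (λ j → A fzero j * φ (setRow fzero (Id j) A))
      ≈⟨ sum-cong-≋ (λ j → *-congˡ {A fzero j} (first-row-unit j)) ⟩
    sum (λ j → A fzero j * φ (embed j (minor fzero j A)))
      ≈⟨ sum-cong-≋ (λ j → *-congˡ {A fzero j} (uniqueness n (embed-alternating alt j) (minor fzero j A))) ⟩
    sum (λ j → A fzero j * (Det n (minor fzero j A) * φ (embed j Id)))
      ≈⟨ sum-cong-≋ (λ j → *-congˡ {A fzero j} (*-congˡ {Det n (minor fzero j A)} (trans (cong (embed-Id j)) (rotate-sign alt j Id)))) ⟩
    sum (λ j → A fzero j * (Det n (minor fzero j A) * sign (toℕ j) (φ Id)))
      ≈⟨ sum-cong-≋ (λ j → regroup (toℕ j) (A fzero j) (Det n (minor fzero j A)) (φ Id)) ⟩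
    sum (λ j → cofactor A j * φ Id)
      ≈⟨ *-distribʳ-sum (φ Id) (cofactor A) ⟨
    sum (cofactor A) * φ Id
      ≈⟨ *-congʳ (det-expand A) ⟨
    Det (suc n) A * φ Id ∎
    where
    open Alternating alt

    first-row-unit : ∀ j → φ (setRow fzero (Id j) A) ≈ φ (embed j (minor fzero j A))
    first-row-unit j = ClearColumn.cleared alt j (setRow fzero (Id j) A) (embed j (minor fzero j A))
      (setRow-hit fzero (Id j) A) (λ c → refl) lower
      where
      lower : ∀ a c → c ≢ j → setRow fzero (Id j) A (fsuc a) c ≈ embed j (minor fzero j A) (fsuc a) c
      lower a c c≢j with j Fin.≟ c
      ... | yes j≡c = ⊥-elim (c≢j (≡.sym j≡c))
      ... | no j≢c  = trans (setRow-miss {r = fzero} (Id j) A (λ ()) c)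
                            (reflexive (≡.cong (A (fsuc a)) (≡.sym (Fin.punchIn-punchOut j≢c))))

    regroup : ∀ k x y z → x * (y * sign k z) ≈ sign k (x * y) * z
    regroup k x y z = begin
      x * (y * sign k z)   ≈⟨ *-congˡ (sign-*ˡ k y z) ⟨
      x * sign k (y * z)   ≈⟨ sign-*ˡ k x (y * z) ⟨
      sign k (x * (y * z)) ≈⟨ sign-cong k (*-assoc x y z) ⟨
      sign k (x * y * z)   ≈⟨ sign-*ʳ k (x * y) z ⟩
      sign k (x * y) * z   ∎

  _⊙_ : ∀ {n} → Mat n → Mat n → Mat n
  _⊙_ = _·_ F

  _≈ᴹ_ : ∀ {n} → Mat n → Mat n → Set ℓ
  _≈ᴹ_ = _≈ₘ_ F

  ⊙-entry : ∀ {n} (A B : Mat n) i k → (A ⊙ B) i k ≈ sum (λ j → A i j * B j k)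
  ⊙-entry {n} A B i k = reflexive (Σᶠ≡sum n (λ j → A i j * B j k))

  ⊙-cong : ∀ {n} {A A′ B B′ : Mat n} → A ≈ᴹ A′ → B ≈ᴹ B′ → (A ⊙ B) ≈ᴹ (A′ ⊙ B′)
  ⊙-cong {A = A} {A′} {B} {B′} A≈ B≈ i k = begin
    (A ⊙ B) i k                 ≈⟨ ⊙-entry A B i k ⟩
    sum (λ j → A i j * B j k)   ≈⟨ sum-cong-≋ (λ j → *-cong (A≈ i j) (B≈ j k)) ⟩
    sum (λ j → A′ i j * B′ j k) ≈⟨ ⊙-entry A′ B′ i k ⟨
    (A′ ⊙ B′) i k               ∎

  ⊙-assoc : ∀ {n} (A B C : Mat n) → ((A ⊙ B) ⊙ C) ≈ᴹ (A ⊙ (B ⊙ C))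
  ⊙-assoc A B C i l = begin
    ((A ⊙ B) ⊙ C) i l                                   ≈⟨ ⊙-entry (A ⊙ B) C i l ⟩
    sum (λ k → (A ⊙ B) i k * C k l)                     ≈⟨ sum-cong-≋ (λ k → *-congʳ (⊙-entry A B i k)) ⟩
    sum (λ k → sum (λ j → A i j * B j k) * C k l)       ≈⟨ sum-cong-≋ (λ k → *-distribʳ-sum (C k l) (λ j → A i j * B j k)) ⟩
    sum (λ k → sum (λ j → A i j * B j k * C k l))       ≈⟨ ∑-comm (λ k j → A i j * B j k * C k l) ⟩
    sum (λ j → sum (λ k → A i j * B j k * C k l))       ≈⟨ sum-cong-≋ (λ j → sum-cong-≋ (λ k → *-assoc (A i j) (B j k) (C k l))) ⟩
    sum (λ j → sum (λ k → A i j * (B j k * C k l)))     ≈⟨ sum-cong-≋ (λ j → *-distribˡ-sum (A i j) (λ k → B j k * C k l)) ⟨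
    sum (λ j → A i j * sum (λ k → B j k * C k l))       ≈⟨ sum-cong-≋ (λ j → *-congˡ (⊙-entry B C j l)) ⟨
    sum (λ j → A i j * (B ⊙ C) j l)                     ≈⟨ ⊙-entry A (B ⊙ C) i l ⟨
    (A ⊙ (B ⊙ C)) i l                                   ∎

  Id-⊙ : ∀ {n} (B : Mat n) → (Id ⊙ B) ≈ᴹ B
  Id-⊙ B i k = trans (⊙-entry Id B i k) (sum-Id-left (λ j → B j k) i)

  ⊙-Id : ∀ {n} (B : Mat n) → (B ⊙ Id) ≈ᴹ B
  ⊙-Id B i k = trans (⊙-entry B Id i k) (sum-Id-right (B i) k)

  ⊙-row : ∀ {n} (A A′ B : Mat n) {i i′} → (∀ j → A i j ≈ A′ i′ j) → ∀ k → (A ⊙ B) i k ≈ (A′ ⊙ B) i′ k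
  ⊙-row A A′ B {i} {i′} same k =
    trans (⊙-entry A B i k) (trans (sum-cong-≋ (λ j → *-congʳ (same j))) (sym (⊙-entry A′ B i′ k)))

  product-alternating : ∀ n (B : Mat n) → Alternating (λ A → Det n (A ⊙ B))
  product-alternating n B = record
    { cong     = λ A≈A′ → det-cong n (⊙-cong A≈A′ (λ _ _ → refl))
    ; linear   = λ r x A A₁ A₂ off on → det-linear n r x (A ⊙ B) (A₁ ⊙ B) (A₂ ⊙ B)
        (λ i k i≢r → ⊙-row A A₁ B (λ j → proj₁ (off i j i≢r)) k , ⊙-row A A₂ B (λ j → proj₂ (off i j i≢r)) k)
        (row-linear r x A A₁ A₂ on)
    ; adjacent = λ r s A s≡r+1 same → Alternating.adjacent (det-alternating n) r s (A ⊙ B) s≡r+1 (⊙-row A A B same)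
    }
    where
    row-linear : ∀ r x (A A₁ A₂ : Mat n) → (∀ j → A r j ≈ x * A₁ r j + A₂ r j) →
      ∀ k → (A ⊙ B) r k ≈ x * (A₁ ⊙ B) r k + (A₂ ⊙ B) r k
    row-linear r x A A₁ A₂ on k = begin
      (A ⊙ B) r k                                                       ≈⟨ ⊙-entry A B r k ⟩
      sum (λ j → A r j * B j k)                                         ≈⟨ sum-cong-≋ (λ j → *-congʳ (on j)) ⟩
      sum (λ j → (x * A₁ r j + A₂ r j) * B j k)                         ≈⟨ sum-cong-≋ (λ j → trans (distribʳ (B j k) (x * A₁ r j) (A₂ r j)) (+-congʳ (*-assoc x (A₁ r j) (B j k)))) ⟩
      sum (λ j → x * (A₁ r j * B j k) + A₂ r j * B j k)                 ≈⟨ ∑-distrib-+ (λ j → x * (A₁ r j * B j k)) (λ j → A₂ r j * B j k) ⟩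
      sum (λ j → x * (A₁ r j * B j k)) + sum (λ j → A₂ r j * B j k)     ≈⟨ +-congʳ (*-distribˡ-sum x (λ j → A₁ r j * B j k)) ⟨
      x * sum (λ j → A₁ r j * B j k) + sum (λ j → A₂ r j * B j k)       ≈⟨ +-cong (*-congˡ (⊙-entry A₁ B r k)) (⊙-entry A₂ B r k) ⟨
      x * (A₁ ⊙ B) r k + (A₂ ⊙ B) r k                                   ∎

  -- multiplicativity, from uniqueness applied to A ↦ det (A B)
  det-⊙ : ∀ n (A B : Mat n) → Det n (A ⊙ B) ≈ Det n A * Det n B
  det-⊙ n A B = trans (uniqueness n (product-alternating n B) A) (*-congˡ (det-cong n (Id-⊙ B)))

  det-Id : ∀ n → Det n Id ≈ 1#
  det-Id zero    = refl
  det-Id (suc n) = begin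
    Det (suc n) I₁                          ≈⟨ det-expand I₁ ⟩
    sum (cofactor I₁)                       ≈⟨ sum-single fzero (cofactor I₁) off-diagonal ⟩
    I₁ fzero fzero * Det n (minor fzero fzero I₁)
                                            ≈⟨ *-cong (Id-diagonal {suc n} fzero)
                                                 (det-cong n (λ a b → Id-resp {i = fsuc a} {fsuc b} {a} {b} Fin.suc-injective (≡.cong fsuc))) ⟩
    1# * Det n Id                           ≈⟨ *-identityˡ _ ⟩
    Det n Id                                ≈⟨ det-Id n ⟩
    1#                                      ∎
    where
    I₁ : Mat (suc n)
    I₁ = Id
    off-diagonal : ∀ j → j ≢ fzero → cofactor I₁ j ≈ 0#
    off-diagonal j j≢0 = trans (sign-cong (toℕ j) (trans (*-congʳ (Id-off (j≢0 ∘ ≡.sym))) (zeroˡ _))) (sign-0 (toℕ j))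

  -- det (A B) = 1 for an inverse B, so det A ≠ 0
  invertible⇒det≉0 : ∀ n (A : Mat n) → Invertible F A → ¬ Det n A ≈ 0#
  invertible⇒det≉0 n A (B , AB≈I , _) det≈0 = 0≉1 (begin
    0#                  ≈⟨ zeroˡ _ ⟨
    0# * Det n B        ≈⟨ *-congʳ det≈0 ⟨
    Det n A * Det n B   ≈⟨ det-⊙ n A B ⟨
    Det n (A ⊙ B)       ≈⟨ det-cong n AB≈I ⟩
    Det n Id            ≈⟨ det-Id n ⟩
    1#                  ∎)

  -- Laplace expansion along row k: rotate row k to the top
  det-expand-row : ∀ {n} (k : Fin (suc n)) (A : Mat (suc n)) →
    Det (suc n) A ≈ sign (toℕ k) (sum (λ j → sign (toℕ j) (A k j * Det n (minor k j A))))
  det-expand-row {n} k A = trans (sym (sign-involutive (toℕ k) (Det (suc n) A)))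
    (sign-cong (toℕ k) (trans (sym (rotate-sign (det-alternating (suc n)) k A)) (det-expand (rotate k A))))

  setRow-self : ∀ {n} (k : Fin n) (A : Mat n) → setRow k (A k) A ≈ᴹ A
  setRow-self k A i j with i Fin.≟ k
  ... | yes ≡.refl = setRow-hit k (A k) A j
  ... | no i≢k     = setRow-miss (A k) A i≢k j

  adjugate : ∀ {n} → Mat (suc n) → Mat (suc n)
  adjugate {n} A j k = sign (toℕ k) (sign (toℕ j) (Det n (minor k j A)))

  adjugate-column : ∀ {n} (A : Mat (suc n)) i k → (A ⊙ adjugate A) i k ≈ Det (suc n) (setRow k (A i) A)
  adjugate-column {n} A i k = begin
    (A ⊙ adjugate A) i k                                            ≈⟨ ⊙-entry A (adjugate A) i k ⟩
    sum (λ j → A i j * sign (toℕ k) (sign (toℕ j) (M j)))           ≈⟨ sum-cong-≋ pull-signs ⟩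
    sum (λ j → sign (toℕ k) (sign (toℕ j) (A i j * M j)))           ≈⟨ sum-sign (toℕ k) (λ j → sign (toℕ j) (A i j * M j)) ⟩
    sign (toℕ k) (sum (λ j → sign (toℕ j) (A i j * M j)))           ≈⟨ sign-cong (toℕ k) (sum-cong-≋ same-terms) ⟩
    sign (toℕ k) (sum (λ j → sign (toℕ j) (A′ k j * Det n (minor k j A′)))) ≈⟨ det-expand-row k A′ ⟨
    Det (suc n) A′                                                  ∎
    where
    A′ : Mat (suc n)
    A′ = setRow k (A i) A
    M : Fin (suc n) → Carrier
    M j = Det n (minor k j A)
    pull-signs : ∀ j → A i j * sign (toℕ k) (sign (toℕ j) (M j)) ≈ sign (toℕ k) (sign (toℕ j) (A i j * M j))
    pull-signs j = trans (sym (sign-*ˡ (toℕ k) _ _)) (sign-cong (toℕ k) (sym (sign-*ˡ (toℕ j) _ _)))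
    same-terms : ∀ j → sign (toℕ j) (A i j * M j) ≈ sign (toℕ j) (A′ k j * Det n (minor k j A′))
    same-terms j = sign-cong (toℕ j) (*-cong (sym (setRow-hit k (A i) A j))
      (det-cong n (λ a b → sym (setRow-miss (A i) A (Fin.punchInᵢ≢i k a) (punchIn j b)))))

  adjugate-right : ∀ {n} (A : Mat (suc n)) i k → (A ⊙ adjugate A) i k ≈ Det (suc n) A * Id i k
  adjugate-right {n} A i k with i Fin.≟ k
  ... | yes ≡.refl = begin
    (A ⊙ adjugate A) i i           ≈⟨ adjugate-column A i i ⟩
    Det (suc n) (setRow i (A i) A) ≈⟨ det-cong (suc n) (setRow-self i A) ⟩
    Det (suc n) A                  ≈⟨ *-identityʳ _ ⟨
    Det (suc n) A * 1#             ∎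
  ... | no i≢k = begin
    (A ⊙ adjugate A) i k           ≈⟨ adjugate-column A i k ⟩
    Det (suc n) (setRow k (A i) A) ≈⟨ equal-rows⇒zero (det-alternating (suc n)) k i (setRow k (A i) A) (i≢k ∘ ≡.sym)
                                        (λ j → trans (setRow-hit k (A i) A j) (sym (setRow-miss (A i) A i≢k j))) ⟩
    0#                             ≈⟨ zeroʳ _ ⟨
    Det (suc n) A * 0#             ∎

  -- over a field, a nonzero determinant gives a right inverse, adj A / det A
  right-inverse : ∀ n (A : Mat n) → ¬ Det n A ≈ 0# → Σ (Mat n) λ C → (A ⊙ C) ≈ᴹ Id
  right-inverse zero    A _      = A , λ ()
  right-inverse (suc n) A det≉0 with inverse (Det (suc n) A) det≉0
  ... | w , det·w≈1 = C , λ i k → begin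
    (A ⊙ C) i k                               ≈⟨ ⊙-entry A C i k ⟩
    sum (λ j → A i j * (w * adjugate A j k))  ≈⟨ sum-cong-≋ (λ j → x∙yz≈y∙xz (A i j) w (adjugate A j k)) ⟩
    sum (λ j → w * (A i j * adjugate A j k))  ≈⟨ *-distribˡ-sum w (λ j → A i j * adjugate A j k) ⟨
    w * sum (λ j → A i j * adjugate A j k)    ≈⟨ *-congˡ (trans (sym (⊙-entry A (adjugate A) i k)) (adjugate-right A i k)) ⟩
    w * (Det (suc n) A * Id i k)              ≈⟨ *-assoc _ _ _ ⟨
    w * Det (suc n) A * Id i k                ≈⟨ *-congʳ (trans (*-comm w _) det·w≈1) ⟩
    1# * Id i k                               ≈⟨ *-identityˡ _ ⟩
    Id i k                                    ∎
    where
    C : Mat (suc n)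
    C j k = w * adjugate A j k

  -- a right inverse C is two-sided: C has a right inverse C′ itself, and
  -- A = A (C C′) = (A C) C′ = C′
  det≉0⇒invertible : ∀ n (A : Mat n) → ¬ Det n A ≈ 0# → Invertible F A
  det≉0⇒invertible n A det≉0 with right-inverse n A det≉0
  ... | C , AC≈I = C , AC≈I , CA≈I
    where
    detC≉0 : ¬ Det n C ≈ 0#
    detC≉0 det≈0 = 0≉1 (begin
      0#                ≈⟨ zeroʳ _ ⟨
      Det n A * 0#      ≈⟨ *-congˡ det≈0 ⟨
      Det n A * Det n C ≈⟨ det-⊙ n A C ⟨
      Det n (A ⊙ C)     ≈⟨ det-cong n AC≈I ⟩
      Det n Id          ≈⟨ det-Id n ⟩
      1#                ∎)
    C′ : Mat n
    C′ = proj₁ (right-inverse n C detC≉0)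
    CC′≈I : (C ⊙ C′) ≈ᴹ Id
    CC′≈I = proj₂ (right-inverse n C detC≉0)
    A≈C′ : A ≈ᴹ C′
    A≈C′ i k = begin
      A i k              ≈⟨ ⊙-Id A i k ⟨
      (A ⊙ Id) i k       ≈⟨ ⊙-cong {A = A} {A} {Id} {C ⊙ C′} (λ _ _ → refl) (λ a b → sym (CC′≈I a b)) i k ⟩
      (A ⊙ (C ⊙ C′)) i k ≈⟨ ⊙-assoc A C C′ i k ⟨
      ((A ⊙ C) ⊙ C′) i k ≈⟨ ⊙-cong {B = C′} {C′} AC≈I (λ _ _ → refl) i k ⟩
      (Id ⊙ C′) i k      ≈⟨ Id-⊙ C′ i k ⟩
      C′ i k             ∎
    CA≈I : (C ⊙ A) ≈ᴹ Id
    CA≈I i k = trans (⊙-cong {A = C} {C} (λ _ _ → refl) A≈C′ i k) (CC′≈I i k)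

  topLeft : ∀ {n} → Mat (suc n) → Mat n
  topLeft A a b = A (inject₁ a) (inject₁ b)

  det-last-row : ∀ n (A : Mat (suc n)) → (∀ j → j ≢ fromℕ n → A (fromℕ n) j ≈ 0#) →
    Det (suc n) A ≈ A (fromℕ n) (fromℕ n) * Det n (topLeft A)
  det-last-row n A last-row = begin
    Det (suc n) A                                                  ≈⟨ det-expand-row l A ⟩
    sign (toℕ l) (sum (λ j → sign (toℕ j) (A l j * Det n (minor l j A))))
      ≈⟨ sign-cong (toℕ l) (sum-single l _ (λ j j≢l → trans (sign-cong (toℕ j) (trans (*-congʳ {Det n (minor l j A)} (last-row j j≢l)) (zeroˡ _)))
                                                          (sign-0 (toℕ j)))) ⟩
    sign (toℕ l) (sign (toℕ l) (A l l * Det n (minor l l A)))      ≈⟨ sign-involutive (toℕ l) _ ⟩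
    A l l * Det n (minor l l A)                                    ≈⟨ *-congˡ (det-cong n (λ a b → reflexive
                                                                         (≡.cong₂ A (punchIn-fromℕ a) (punchIn-fromℕ b)))) ⟩
    A l l * Det n (topLeft A)                                      ∎
    where
    l : Fin (suc n)
    l = fromℕ n

  -- Corner lemma: if A and B agree outside the bottom-right corner, then
  -- det A = det B + (A_nn - B_nn) · det (topLeft A), by linearity in the last row.
  det-corner : ∀ n (A B : Mat (suc n)) → (∀ i j → toℕ i < n ⊎ toℕ j < n → A i j ≈ B i j) →
    Det (suc n) A ≈ Det (suc n) B + (A (fromℕ n) (fromℕ n) + - B (fromℕ n) (fromℕ n)) * Det n (topLeft A)
  det-corner n A B agree = begin
    Det (suc n) A                       ≈⟨ Alternating.linear (det-alternating (suc n)) l 1# A C B off on ⟩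
    1# * Det (suc n) C + Det (suc n) B  ≈⟨ +-comm _ _ ⟩
    Det (suc n) B + 1# * Det (suc n) C  ≈⟨ +-congˡ (*-identityˡ _) ⟩
    Det (suc n) B + Det (suc n) C       ≈⟨ +-congˡ (det-last-row n C difference-at-corner) ⟩
    Det (suc n) B + C l l * Det n (topLeft C)
      ≈⟨ +-congˡ (*-cong (setRow-hit l d A l) (det-cong n (λ a b → setRow-miss d A (inject₁≢l a) (inject₁ b)))) ⟩
    Det (suc n) B + (A l l + - B l l) * Det n (topLeft A) ∎
    where
    l : Fin (suc n)
    l = fromℕ n
    d : Row (suc n)
    d j = A l j + - B l j
    C : Mat (suc n)
    C = setRow l d A
    inject₁≢l : ∀ a → inject₁ a ≢ l
    inject₁≢l a e = ℕ.<-irrefl (≡.trans (≡.sym (Fin.toℕ-inject₁ a)) (≡.trans (≡.cong toℕ e) (Fin.toℕ-fromℕ n)))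
                               (Fin.toℕ<n a)
    off : ∀ i j → i ≢ l → A i j ≈ C i j × A i j ≈ B i j
    off i j i≢l = sym (setRow-miss d A i≢l j) , agree i j (inj₁ (≢fromℕ⇒< i i≢l))
    on : ∀ j → A l j ≈ 1# * C l j + B l j
    on j = sym (begin
      1# * C l j + B l j ≈⟨ +-congʳ (trans (*-identityˡ _) (setRow-hit l d A j)) ⟩
      d j + B l j        ≈⟨ //-rightDividesˡ (B l j) (A l j) ⟩
      A l j              ∎)
    difference-at-corner : ∀ j → j ≢ l → C l j ≈ 0#
    difference-at-corner j j≢l = trans (setRow-hit l d A j) (x≈y⇒x∙y⁻¹≈ε (agree l j (inj₂ (≢fromℕ⇒< j j≢l))))

module Squares {c ℓ : Level} (F : Field c ℓ) where

  open Field F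
  open Determinant F
  open import Algebra.Properties.Ring ring using (+-identityʳ-unique; x∙y⁻¹≈ε⇒x≈y; //-rightDividesˡ; -0#≈0#)
  open import Relation.Binary.Reasoning.Setoid setoid

  cancel-nonzero : ∀ {x y} → ¬ y ≈ 0# → x * y ≈ 0# → x ≈ 0#
  cancel-nonzero {x} {y} y≉0 xy≈0 with inverse y y≉0
  ... | w , yw≈1 = begin
    x           ≈⟨ *-identityʳ x ⟨
    x * 1#      ≈⟨ *-congˡ yw≈1 ⟨
    x * (y * w) ≈⟨ *-assoc x y w ⟨
    x * y * w   ≈⟨ *-congʳ xy≈0 ⟩
    0# * w      ≈⟨ zeroˡ w ⟩
    0#          ∎

  Grid : Set c
  Grid = ℕ → ℕ → Carrier

  square : Grid → (k t : ℕ) → Mat k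
  square G k t a b = G (toℕ a) (t +ℕ toℕ b)

  squareDet : Grid → ℕ → ℕ → Carrier
  squareDet G k t = Det k (square G k t)

  square-topLeft : ∀ G k t → Det k (topLeft (square G (suc k) t)) ≈ squareDet G k t
  square-topLeft G k t = det-cong k (λ a b →
    reflexive (≡.cong₂ G (Fin.toℕ-inject₁ a) (≡.cong (t +ℕ_) (Fin.toℕ-inject₁ b))))

  square-corner : ∀ G k t → square G (suc k) t (fromℕ k) (fromℕ k) ≡ G k (t +ℕ k)
  square-corner G k t = ≡.cong₂ G (Fin.toℕ-fromℕ k) (≡.cong (t +ℕ_) (Fin.toℕ-fromℕ k))

  square-column≤ : ∀ {k} t (j : Fin (suc k)) → t +ℕ toℕ j ≤ t +ℕ k
  square-column≤ t j = ℕ.+-monoʳ-≤ t (s≤s⁻¹ (Fin.toℕ<n j))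

  -- Entry (x , t+x) is the corner of the square of size x+1 at column t; all
  -- its other entries come earlier in row-major order, and the corner lemma
  -- determines the corner from them.
  rigidity : ∀ d (G G′ : Grid) →
    (∀ x y → y < x → x ≤ d → G x y ≈ G′ x y) →
    (∀ k t → k +ℕ t ≤ suc d → squareDet G k t ≈ squareDet G′ k t) →
    (∀ k t → k +ℕ t ≤ d → ¬ squareDet G k t ≈ 0#) →
    ∀ x y → x ≤ d → y ≤ d → G x y ≈ G′ x y
  rigidity d G G′ below same-det nonzero = <-rec RowAgrees row
    where
    Agree : ℕ → ℕ → Set ℓ
    Agree x y = x ≤ d → y ≤ d → G x y ≈ G′ x y

    RowAgrees : ℕ → Set ℓ
    RowAgrees x = ∀ y → Agree x y

    row : ∀ x → (∀ {x′} → x′ < x → RowAgrees x′) → RowAgrees x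
    row x earlier = <-rec (Agree x) entry
      where
      corner : ∀ t → (∀ {y′} → y′ < t +ℕ x → Agree x y′) → t +ℕ x ≤ d → G x (t +ℕ x) ≈ G′ x (t +ℕ x)
      corner t left t+x≤d = begin
        G x (t +ℕ x)            ≡⟨ square-corner G x t ⟨
        A (fromℕ x) (fromℕ x)   ≈⟨ x∙y⁻¹≈ε⇒x≈y _ _ corners-agree ⟩
        B (fromℕ x) (fromℕ x)   ≡⟨ square-corner G′ x t ⟩
        G′ x (t +ℕ x)           ∎
        where
        A B : Mat (suc x)
        A = square G (suc x) t
        B = square G′ (suc x) t
        x+t≤d : x +ℕ t ≤ d
        x+t≤d = ≡.subst (_≤ d) (ℕ.+-comm t x) t+x≤d
        x≤d : x ≤ d
        x≤d = ℕ.m+n≤o⇒m≤o x x+t≤d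
        off-corner : ∀ i j → toℕ i < x ⊎ toℕ j < x → A i j ≈ B i j
        off-corner i j i<x⊎j<x with toℕ i <? x | i<x⊎j<x
        ... | yes i<x | _       = earlier i<x (t +ℕ toℕ j) (ℕ.≤-trans (ℕ.<⇒≤ i<x) x≤d)
                                          (ℕ.≤-trans (square-column≤ t j) t+x≤d)
        ... | no i≮x  | inj₁ i<x = ⊥-elim (i≮x i<x)
        ... | no i≮x  | inj₂ j<x = ≡.subst (λ z → G z (t +ℕ toℕ j) ≈ G′ z (t +ℕ toℕ j)) (≡.sym i≡x)
                                     (left (ℕ.+-monoʳ-< t j<x) x≤d (ℕ.≤-trans (square-column≤ t j) t+x≤d))
          where
          i≡x : toℕ i ≡ x
          i≡x = ℕ.≤-antisym (s≤s⁻¹ (Fin.toℕ<n i)) (ℕ.≮⇒≥ i≮x)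
        difference·minor≈0 : (A (fromℕ x) (fromℕ x) + - B (fromℕ x) (fromℕ x)) * Det x (topLeft A) ≈ 0#
        difference·minor≈0 = +-identityʳ-unique (Det (suc x) B) _
          (trans (sym (det-corner x A B off-corner)) (same-det (suc x) t (s≤s x+t≤d)))
        corners-agree : A (fromℕ x) (fromℕ x) + - B (fromℕ x) (fromℕ x) ≈ 0#
        corners-agree = cancel-nonzero (λ minor≈0 → nonzero x t x+t≤d (trans (sym (square-topLeft G x t)) minor≈0))
                                       difference·minor≈0

      entry : ∀ y → (∀ {y′} → y′ < y → Agree x y′) → Agree x y
      entry y left x≤d y≤d with y <? x
      ... | yes y<x = below x y y<x x≤d
      ... | no y≮x  = ≡.subst (λ z → (∀ {y′} → y′ < z → Agree x y′) → z ≤ d → G x z ≈ G′ x z)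
                              (ℕ.m∸n+n≡m (ℕ.≮⇒≥ y≮x)) (corner (y ∸ x)) left y≤d

  -- The entries are chosen in row-major order; entry (x , t+x) is the corner of
  -- the square of size x+1 at column t, and by the corner lemma it can be
  -- chosen to give that square the determinant Φ (x+1) t.
  module Realization (d : ℕ) (Φ : ℕ → ℕ → Carrier)
    (Φ-empty : ∀ t → Φ 0 t ≈ 1#) (Φ≉0 : ∀ k t → k +ℕ t ≤ d → ¬ Φ k t ≈ 0#) where

    reciprocal : ℕ → ℕ → Carrier
    reciprocal k t with k +ℕ t ≤? d
    ... | yes k+t≤d = proj₁ (inverse (Φ k t) (Φ≉0 k t k+t≤d))
    ... | no _      = 0#

    reciprocal-spec : ∀ {k t} → k +ℕ t ≤ d → reciprocal k t * Φ k t ≈ 1#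
    reciprocal-spec {k} {t} k+t≤d with k +ℕ t ≤? d
    ... | yes k+t≤d′ = trans (*-comm _ _) (proj₂ (inverse (Φ k t) (Φ≉0 k t k+t≤d′)))
    ... | no k+t≰d   = ⊥-elim (k+t≰d k+t≤d)

    set : Grid → ℕ → ℕ → Carrier → Grid
    set G x y v x′ y′ with x′ ℕ.≟ x | y′ ℕ.≟ y
    ... | yes _ | yes _ = v
    ... | _     | _     = G x′ y′

    set-hit : ∀ G x y v → set G x y v x y ≡ v
    set-hit G x y v with x ℕ.≟ x | y ℕ.≟ y
    ... | yes _  | yes _  = ≡.refl
    ... | no x≢x | _      = ⊥-elim (x≢x ≡.refl)
    ... | yes _  | no y≢y = ⊥-elim (y≢y ≡.refl)

    set-row : ∀ G x y v {x′} y′ → x′ ≢ x → set G x y v x′ y′ ≡ G x′ y′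
    set-row G x y v {x′} y′ x′≢x with x′ ℕ.≟ x | y′ ℕ.≟ y
    ... | yes x′≡x | _     = ⊥-elim (x′≢x x′≡x)
    ... | no _     | _     = ≡.refl

    set-column : ∀ G x y v x′ {y′} → y′ ≢ y → set G x y v x′ y′ ≡ G x′ y′
    set-column G x y v x′ {y′} y′≢y with x′ ℕ.≟ x | y′ ℕ.≟ y
    ... | _     | yes y′≡y = ⊥-elim (y′≢y y′≡y)
    ... | yes _ | no _     = ≡.refl
    ... | no _  | no _     = ≡.refl

    mutual
      -- the grid holding the entries before (x , y) in row-major order within
      -- columns 0 … d (all of rows 0 … x-1, and row x up to column y-1), zero elsewhere
      stage : ℕ → ℕ → Grid
      stage x       (suc y) = set (stage x y) x y (entry x y)
      stage zero    zero    = λ _ _ → 0#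
      stage (suc x) zero    = stage x (suc d)

      -- entry (x , y): zero below the diagonal; on or above it, chosen so that
      -- the square with corner (x , y) gets determinant Φ (x+1) (y-x)
      entry : ℕ → ℕ → Carrier
      entry x y with y <? x
      ... | yes _ = 0#
      ... | no _  = (Φ (suc x) (y ∸ x) + - squareDet (stage x y) (suc x) (y ∸ x)) * reciprocal x (y ∸ x)

    stage-later-row : ∀ x y x′ y′ → x < x′ → stage x y x′ y′ ≡ 0#
    stage-later-row zero    zero    x′ y′ x<x′ = ≡.refl
    stage-later-row (suc x) zero    x′ y′ x<x′ = stage-later-row x (suc d) x′ y′ (ℕ.<-trans (ℕ.n<1+n x) x<x′)
    stage-later-row x       (suc y) x′ y′ x<x′ =
      ≡.trans (set-row (stage x y) x y (entry x y) y′ (ℕ.<⇒≢ x<x′ ∘ ≡.sym)) (stage-later-row x y x′ y′ x<x′)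

    stage-later-column : ∀ x y y′ → y ≤ y′ → stage x y x y′ ≡ 0#
    stage-later-column zero    zero    y′ y≤y′ = ≡.refl
    stage-later-column (suc x) zero    y′ y≤y′ = stage-later-row x (suc d) (suc x) y′ (ℕ.n<1+n x)
    stage-later-column x       (suc y) y′ y<y′ =
      ≡.trans (set-column (stage x y) x y (entry x y) x (ℕ.<⇒≢ y<y′ ∘ ≡.sym)) (stage-later-column x y y′ (ℕ.<⇒≤ y<y′))

    stage-earlier-column : ∀ x y y′ → y′ < y → stage x y x y′ ≡ entry x y′
    stage-earlier-column x (suc y) y′ y′<y+1 with ℕ.m≤n⇒m<n∨m≡n (s≤s⁻¹ y′<y+1)
    ... | inj₁ y′<y   = ≡.trans (set-column (stage x y) x y (entry x y) x (ℕ.<⇒≢ y′<y))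
                                (stage-earlier-column x y y′ y′<y)
    ... | inj₂ ≡.refl = set-hit (stage x y) x y (entry x y)

    stage-earlier-row : ∀ x y x′ y′ → x′ < x → y′ ≤ d → stage x y x′ y′ ≡ entry x′ y′
    stage-earlier-row (suc x) zero    x′ y′ x′<x+1 y′≤d with ℕ.m≤n⇒m<n∨m≡n (s≤s⁻¹ x′<x+1)
    ... | inj₁ x′<x    = stage-earlier-row x (suc d) x′ y′ x′<x y′≤d
    ... | inj₂ ≡.refl  = stage-earlier-column x′ (suc d) y′ (s≤s y′≤d)
    stage-earlier-row x       (suc y) x′ y′ x′<x y′≤d =
      ≡.trans (set-row (stage x y) x y (entry x y) y′ (ℕ.<⇒≢ x′<x)) (stage-earlier-row x y x′ y′ x′<x y′≤d)

    entry-below : ∀ x y → y < x → entry x y ≡ 0#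
    entry-below x y y<x with y <? x
    ... | yes _   = ≡.refl
    ... | no y≮x  = ⊥-elim (y≮x y<x)

    entry-corner : ∀ x t → entry x (t +ℕ x)
      ≡ (Φ (suc x) t + - squareDet (stage x (t +ℕ x)) (suc x) t) * reciprocal x t
    entry-corner x t with t +ℕ x <? x
    ... | yes t+x<x = ⊥-elim (ℕ.m+n≮n t x t+x<x)
    ... | no _      rewrite ℕ.m+n∸n≡m t x = ≡.refl

    realizes : ∀ k t → k +ℕ t ≤ suc d → squareDet entry k t ≈ Φ k t
    realizes zero    t _          = sym (Φ-empty t)
    realizes (suc x) t x+t<d+1 = begin
      Det (suc x) A                                          ≈⟨ det-corner x A B off-corner ⟩
      β + (A (fromℕ x) (fromℕ x) + - B (fromℕ x) (fromℕ x)) * Det x (topLeft A)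
        ≈⟨ +-congˡ (*-cong corner-difference (trans (square-topLeft entry x t) (realizes x t (ℕ.<⇒≤ x+t<d+1)))) ⟩
      β + (Φ (suc x) t + - β) * reciprocal x t * Φ x t       ≈⟨ +-congˡ (*-assoc _ _ _) ⟩
      β + (Φ (suc x) t + - β) * (reciprocal x t * Φ x t)     ≈⟨ +-congˡ (*-congˡ (reciprocal-spec x+t≤d)) ⟩
      β + (Φ (suc x) t + - β) * 1#                           ≈⟨ +-congˡ (*-identityʳ _) ⟩
      β + (Φ (suc x) t + - β)                                ≈⟨ +-comm _ _ ⟩
      Φ (suc x) t + - β + β                                  ≈⟨ //-rightDividesˡ β (Φ (suc x) t) ⟩
      Φ (suc x) t                                            ∎
      where
      y : ℕ
      y = t +ℕ x
      A B : Mat (suc x)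
      A = square entry (suc x) t
      B = square (stage x y) (suc x) t
      β : Carrier
      β = Det (suc x) B
      x+t≤d : x +ℕ t ≤ d
      x+t≤d = s≤s⁻¹ x+t<d+1
      y≤d : y ≤ d
      y≤d = ≡.subst (_≤ d) (ℕ.+-comm x t) x+t≤d
      off-corner : ∀ i j → toℕ i < x ⊎ toℕ j < x → A i j ≈ B i j
      off-corner i j i<x⊎j<x with toℕ i <? x | i<x⊎j<x
      ... | yes i<x | _        = reflexive (≡.sym (stage-earlier-row x y (toℕ i) (t +ℕ toℕ j) i<x
                                                     (ℕ.≤-trans (square-column≤ t j) y≤d)))
      ... | no i≮x  | inj₁ i<x = ⊥-elim (i≮x i<x)
      ... | no i≮x  | inj₂ j<x = reflexive (≡.subst (λ z → entry z (t +ℕ toℕ j) ≡ stage x y z (t +ℕ toℕ j)) (≡.sym i≡x)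
                                              (≡.sym (stage-earlier-column x y (t +ℕ toℕ j) (ℕ.+-monoʳ-< t j<x))))
        where
        i≡x : toℕ i ≡ x
        i≡x = ℕ.≤-antisym (s≤s⁻¹ (Fin.toℕ<n i)) (ℕ.≮⇒≥ i≮x)
      corner-difference : A (fromℕ x) (fromℕ x) + - B (fromℕ x) (fromℕ x) ≈ (Φ (suc x) t + - β) * reciprocal x t
      corner-difference = begin
        A (fromℕ x) (fromℕ x) + - B (fromℕ x) (fromℕ x)
          ≡⟨ ≡.cong₂ (λ a b → a + - b) (≡.trans (square-corner entry x t) (entry-corner x t))
                                       (≡.trans (square-corner (stage x y) x t) (stage-later-column x y y ℕ.≤-refl)) ⟩
        (Φ (suc x) t + - β) * reciprocal x t + - 0#      ≈⟨ +-congˡ -0#≈0# ⟩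
        (Φ (suc x) t + - β) * reciprocal x t + 0#        ≈⟨ +-identityʳ _ ⟩
        (Φ (suc x) t + - β) * reciprocal x t             ∎

module Δ {d : ℕ} (r s t : ℕ) (p : r +ℕ s +ℕ t ≡ d) where

  d≡r+[s+t] : d ≡ r +ℕ (s +ℕ t)
  d≡r+[s+t] = ≡.trans (≡.sym p) (ℕ.+-assoc r s t)

  -- the square of D(T)(r , s , t) has size s + 1
  d∸r∸t≡s : (d ∸ r) ∸ t ≡ s
  d∸r∸t≡s = ≡.trans (≡.cong (λ n → (n ∸ r) ∸ t) d≡r+[s+t])
                 (≡.trans (≡.cong (_∸ t) (ℕ.m+n∸m≡n r (s +ℕ t))) (ℕ.m+n∸n≡m s t))

  d∸[s+t]≡r : d ∸ (s +ℕ t) ≡ r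
  d∸[s+t]≡r = ≡.trans (≡.cong (_∸ (s +ℕ t)) d≡r+[s+t]) (ℕ.m+n∸n≡m r (s +ℕ t))

  s+t≤d : s +ℕ t ≤ d
  s+t≤d = ≡.subst (s +ℕ t ≤_) (≡.sym d≡r+[s+t]) (ℕ.m≤n+m (s +ℕ t) r)

Δ-point : ∀ {d} s t → s +ℕ t ≤ d → d ∸ (s +ℕ t) +ℕ s +ℕ t ≡ d
Δ-point {d} s t s+t≤d = ≡.trans (ℕ.+-assoc (d ∸ (s +ℕ t)) s t) (ℕ.m∸n+n≡m s+t≤d)

module Bijection {c ℓ : Level} (F : Field c ℓ) (d : ℕ) where

  open Field F
  open Determinant F
  open Squares F
  open import Relation.Binary.Reasoning.Setoid setoid

  1≉0 : ¬ 1# ≈ 0#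
  1≉0 = 0≉1 ∘ sym

  -- the entries of a (d+1)×(d+1) matrix as a grid; T[i,j] is then the square
  -- of size j-i+1 at column i of this grid, by the definition of sub
  grid : Mat (suc d) → Grid
  grid M = at F M

  grid-inside : ∀ M {x y} (x<n : x < suc d) (y<n : y < suc d) → grid M x y ≡ M (fromℕ< x<n) (fromℕ< y<n)
  grid-inside M {x} {y} x<n y<n with x <? suc d | y <? suc d
  ... | yes _    | yes _    = ≡.refl
  ... | no x≮n  | _        = ⊥-elim (x≮n x<n)
  ... | yes _    | no y≮n  = ⊥-elim (y≮n y<n)

  grid-entry : ∀ M (i j : Fin (suc d)) → grid M (toℕ i) (toℕ j) ≡ M i j
  grid-entry M i j = ≡.trans (grid-inside M (Fin.toℕ<n i) (Fin.toℕ<n j))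
                             (≡.cong₂ M (Fin.fromℕ<-toℕ i (Fin.toℕ<n i)) (Fin.fromℕ<-toℕ j (Fin.toℕ<n j)))

  grid-below : ∀ M → UpperTriangular F M → ∀ x y → y < x → x ≤ d → grid M x y ≈ 0#
  grid-below M upper x y y<x x≤d = trans (reflexive (grid-inside M x<n y<n))
    (upper (fromℕ< x<n) (fromℕ< y<n) (≡.subst₂ _<_ (≡.sym (Fin.toℕ-fromℕ< y<n)) (≡.sym (Fin.toℕ-fromℕ< x<n)) y<x))
    where
    x<n : x < suc d
    x<n = s≤s x≤d
    y<n : y < suc d
    y<n = ℕ.<-trans y<x x<n

  D-square : ∀ M r s t (p : r +ℕ s +ℕ t ≡ d) → D F d M r s t p ≈ squareDet (grid M) (suc s) t
  D-square M r s t p = reflexive (≡.cong (λ k → squareDet (grid M) (suc k) t) (Δ.d∸r∸t≡s r s t p))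

  very-good-squares : ∀ M → VeryGood F d M → ∀ k t → k +ℕ t ≤ suc d → ¬ squareDet (grid M) k t ≈ 0#
  very-good-squares M very-good zero    t _       = 1≉0
  very-good-squares M very-good (suc s) t s+t<d+1 det≈0 =
    invertible⇒det≉0 _ (sub F M t (s +ℕ t)) (very-good t (s +ℕ t) (ℕ.m≤n+m t s) (s≤s⁻¹ s+t<d+1))
      (trans (reflexive (≡.cong (λ k → squareDet (grid M) (suc k) t) (ℕ.m+n∸n≡m s t))) det≈0)

  nonvanishing : (T : 𝒯 F d) → let (M , _) = T in NonVanishing F (D F d M)
  nonvanishing (M , _ , very-good) r s t p det≈0 =
    very-good-squares M very-good (suc s) t (s≤s (Δ.s+t≤d r s t p)) (trans (sym (D-square M r s t p)) det≈0)

  injective : (T T′ : 𝒯 F d) → let (M , _) = T in let (M′ , _) = T′ in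
    _≈Δ_ F (D F d M) (D F d M′) → _≈ₘ_ F M M′
  injective (M , upper , very-good) (M′ , upper′ , _) same-D i j = begin
    M i j                      ≡⟨ grid-entry M i j ⟨
    grid M (toℕ i) (toℕ j)     ≈⟨ rigidity d (grid M) (grid M′) below same-squares nonzero (toℕ i) (toℕ j)
                                    (s≤s⁻¹ (Fin.toℕ<n i)) (s≤s⁻¹ (Fin.toℕ<n j)) ⟩
    grid M′ (toℕ i) (toℕ j)    ≡⟨ grid-entry M′ i j ⟩
    M′ i j                     ∎
    where
    below : ∀ x y → y < x → x ≤ d → grid M x y ≈ grid M′ x y
    below x y y<x x≤d = trans (grid-below M upper x y y<x x≤d) (sym (grid-below M′ upper′ x y y<x x≤d))
    same-squares : ∀ k t → k +ℕ t ≤ suc d → squareDet (grid M) k t ≈ squareDet (grid M′) k t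
    same-squares zero    t _       = refl
    same-squares (suc s) t s+t<d+1 = begin
      squareDet (grid M) (suc s) t  ≈⟨ D-square M _ s t p ⟨
      D F d M _ s t p               ≈⟨ same-D _ s t p ⟩
      D F d M′ _ s t p              ≈⟨ D-square M′ _ s t p ⟩
      squareDet (grid M′) (suc s) t ∎
      where
      p : d ∸ (s +ℕ t) +ℕ s +ℕ t ≡ d
      p = Δ-point s t (s≤s⁻¹ s+t<d+1)
    nonzero : ∀ k t → k +ℕ t ≤ d → ¬ squareDet (grid M) k t ≈ 0#
    nonzero k t k+t≤d = very-good-squares M very-good k t (ℕ.m≤n⇒m≤1+n k+t≤d)

  module Construction (f : FunΔ F d) (f≉0 : NonVanishing F f) where

    f-resp : ∀ {r r′} s t (p : r +ℕ s +ℕ t ≡ d) (p′ : r′ +ℕ s +ℕ t ≡ d) → r ≡ r′ → f r s t p ≈ f r′ s t p′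
    f-resp s t p p′ ≡.refl = reflexive (≡.cong (f _ s t) (ℕ.≡-irrelevant p p′))

    Φ : ℕ → ℕ → Carrier
    Φ zero    t = 1#
    Φ (suc s) t with s +ℕ t ≤? d
    ... | yes s+t≤d = f (d ∸ (s +ℕ t)) s t (Δ-point s t s+t≤d)
    ... | no _      = 1#

    Φ-spec : ∀ r s t p → Φ (suc s) t ≈ f r s t p
    Φ-spec r s t p with s +ℕ t ≤? d
    ... | yes s+t≤d = f-resp s t (Δ-point s t s+t≤d) p (Δ.d∸[s+t]≡r r s t p)
    ... | no s+t≰d  = ⊥-elim (s+t≰d (Δ.s+t≤d r s t p))

    Φ≉0 : ∀ k t → k +ℕ t ≤ suc d → ¬ Φ k t ≈ 0#
    Φ≉0 zero    t _       = 1≉0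
    Φ≉0 (suc s) t s+t<d+1 Φ≈0 = f≉0 _ s t p (trans (sym (Φ-spec _ s t p)) Φ≈0)
      where
      p : d ∸ (s +ℕ t) +ℕ s +ℕ t ≡ d
      p = Δ-point s t (s≤s⁻¹ s+t<d+1)

    open Realization d Φ (λ _ → refl) (λ k t k+t≤d → Φ≉0 k t (ℕ.m≤n⇒m≤1+n k+t≤d))

    T : Mat (suc d)
    T i j = entry (toℕ i) (toℕ j)

    upper : UpperTriangular F T
    upper i j j<i = reflexive (entry-below (toℕ i) (toℕ j) j<i)

    grid-T : ∀ {x y} → x < suc d → y < suc d → grid T x y ≈ entry x y
    grid-T x<n y<n = reflexive (≡.trans (grid-inside T x<n y<n) (≡.cong₂ entry (Fin.toℕ-fromℕ< x<n) (Fin.toℕ-fromℕ< y<n)))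

    squares-T : ∀ k t → k +ℕ t ≤ suc d → squareDet (grid T) k t ≈ Φ k t
    squares-T k t k+t≤d+1 = trans (det-cong k (λ a b → grid-T (row a) (column b))) (realizes k t k+t≤d+1)
      where
      row : ∀ (a : Fin k) → toℕ a < suc d
      row a = ℕ.<-≤-trans (Fin.toℕ<n a) (ℕ.m+n≤o⇒m≤o k k+t≤d+1)
      column : ∀ (b : Fin k) → t +ℕ toℕ b < suc d
      column b = ℕ.<-≤-trans (ℕ.+-monoʳ-< t (Fin.toℕ<n b)) (≡.subst (_≤ suc d) (ℕ.+-comm k t) k+t≤d+1)

    very-good : VeryGood F d T
    very-good i j i≤j j≤d = det≉0⇒invertible _ (sub F T i j) (λ det≈0 →
      Φ≉0 (suc (j ∸ i)) i in-range (trans (sym (squares-T (suc (j ∸ i)) i in-range)) det≈0))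
      where
      in-range : suc (j ∸ i) +ℕ i ≤ suc d
      in-range = s≤s (≡.subst (_≤ d) (≡.sym (ℕ.m∸n+n≡m i≤j)) j≤d)

    D-T : _≈Δ_ F (D F d T) f
    D-T r s t p = begin
      D F d T r s t p             ≈⟨ D-square T r s t p ⟩
      squareDet (grid T) (suc s) t ≈⟨ squares-T (suc s) t (s≤s (Δ.s+t≤d r s t p)) ⟩
      Φ (suc s) t                 ≈⟨ Φ-spec r s t p ⟩
      f r s t p                   ∎

  surjective : (f : FunΔ F d) → NonVanishing F f →
    Σ (𝒯 F d) λ T → let (M , _) = T in _≈Δ_ F (D F d M) f
  surjective f f≉0 = (T , upper , very-good) , D-T
    where open Construction f f≉0


lemma8p4 : {c ℓ : Level} (F : Field c ℓ) (d : ℕ) →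
    -- D is well defined: D(T) takes values in F ∖ {0}
    ((T : 𝒯 F d) → let (M , _) = T in NonVanishing F (D F d M))
    -- D is injective
    × ((T T′ : 𝒯 F d) → let (M , _) = T in let (M′ , _) = T′ in
        _≈Δ_ F (D F d M) (D F d M′) → _≈ₘ_ F M M′)
    -- D is surjective onto VF_d(F)
    × ((f : FunΔ F d) → NonVanishing F f →
        Σ (𝒯 F d) λ T → let (M , _) = T in _≈Δ_ F (D F d M) f)
lemma8p4 F d = nonvanishing , injective , surjective
  where open Bijection F d
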